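{- Let $\rho,\tau$ satisfy $\rho+\tau<1$. Then there are constants $c_0,c_1>0$ (depending only on $\tau,\rho$) such that with high probability the number of $\alpha$-nodes that are unhappy in the initial state of the Schelling process $(n,w,\tau,\rho)$ lies between $n e^{ -c_0 w}$ and $n e^{ -c_1 w}$; that is, it is $n\cdot e^{ -\Theta(w)}$.
   Context: The Schelling process $(n,w,\tau,\rho)$: $n$ sites $0,\dots,n-1$ on a circle (site arithmetic mod $n$), each with a node of type $\alpha$ or $\beta$; in the initial state types are assigned independently, each node being of type $\beta$ with probability $\rho\le 0.5$. The neighbourhood of node $u$ is the set of $2w+1$ nodes at sites $u-w,\dots,u+w$. A node is happy if the proportion of nodes in its neighbourhood of its own type is at least $\tau$, else unhappy. "With high probability $R$" means: for every $\epsilon>0$ there is $w_0$ such that for all $w\ge w_0$ there is $n_0$ such that for all $n\ge n_0$, $R$ holds with probability at least $1-\epsilon$.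
   Formalization: The parameters ρ and τ of the Schelling process are rational, as is the error bound ε>0 in the meaning of with high probability. -}

module Defs where

open import Data.Bool using (Bool; true; false; _∧_; not; if_then_else_)
open import Data.Nat using (ℕ; zero; suc; _∸_) renaming (_+_ to _+ℕ_; _*_ to _*ℕ_)
open import Data.Nat.DivMod using (_%_)
open import Data.List using (List; []; _∷_; map; concatMap; length; upTo; filter; foldr)
open import Data.Integer using (+_)
open import Data.Rational using (ℚ; 0ℚ; 1ℚ; _+_; _*_; _-_; _/_)
open import Data.Rational.Properties using (_<?_)
open import Relation.Nullary.Decidable using (does)

-- Type of a node: true = β, false = α.
-- A configuration on n sites is a list of n types (site i ↦ i-th entry).

configs : ℕ → List (List Bool)
configs zero    = [] ∷ []
configs (suc n) = concatMap (λ xs → (false ∷ xs) ∷ (true ∷ xs) ∷ []) (configs n)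

nth : List Bool → ℕ → Bool
nth []       _       = false
nth (x ∷ xs) zero    = x
nth (x ∷ xs) (suc k) = nth xs k

typeAt : List Bool → ℕ → Bool
typeAt []       k = false
typeAt (x ∷ xs) k = nth (x ∷ xs) (k % suc (length xs))

sameB : Bool → Bool → Bool
sameB true  true  = true
sameB false false = true
sameB _     _     = false

-- number of nodes in the neighbourhood {u-w,…,u+w} (mod n) of u having u's type
-- (site u - w + j is written (u + n*w + j) ∸ w to stay in ℕ; equal mod n)
sameCount : List Bool → ℕ → ℕ → ℕ
sameCount xs w u =
  length (filter (λ j → sameB (typeAt xs ((u +ℕ length xs *ℕ w +ℕ j) ∸ w)) (typeAt xs u) Data.Bool.≟ true)
                 (upTo (suc (w +ℕ w))))
  where import Data.Bool

unhappyB : ℚ → List Bool → ℕ → ℕ → Bool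
unhappyB τ xs w u = does ((+ sameCount xs w u) / suc (w +ℕ w) <? τ)

unhappyAlphaCount : ℚ → List Bool → ℕ → ℕ
unhappyAlphaCount τ xs w =
  length (filter (λ u → (not (typeAt xs u) ∧ unhappyB τ xs w u) Data.Bool.≟ true) (upTo (length xs)))
  where import Data.Bool

_^ℚ_ : ℚ → ℕ → ℚ
q ^ℚ zero  = 1ℚ
q ^ℚ suc k = q * (q ^ℚ k)

countB : List Bool → ℕ
countB []           = 0
countB (true ∷ xs)  = suc (countB xs)
countB (false ∷ xs) = countB xs

weight : ℚ → List Bool → ℚ
weight ρ xs = (ρ ^ℚ countB xs) * ((1ℚ - ρ) ^ℚ (length xs ∸ countB xs))

Prob : ℚ → (n : ℕ) → (List Bool → Bool) → ℚ
Prob ρ n E = foldr (λ xs acc → (if E xs then weight ρ xs else 0ℚ) + acc) 0ℚ (configs n)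

ℕtoℚ : ℕ → ℚ
ℕtoℚ k = (+ k) / 1

-- Cut the first m(2w+1) sites, m = ⌊n/(2w+1)⌋, into m disjoint blocks of length
-- 2w+1. A block β^w α β^w has an unhappy α at its centre as soon as 1/(2w+1) < τ; the blocks
-- are independent and each has this shape with probability p = ρ^{2w}(1-ρ), so by Chebyshev's
-- inequality at least m p/2 ≥ n (ρ²/32)^w of them occur with high probability.
--
-- An α-node u is unhappy only if its neighbourhood holds fewer than τ(2w+1)
-- α-nodes. Pick a/b with τ < a/b < σ = 1-ρ; for suitable θ < 1 the exponential moment of θ^{b·#α}
-- over the neighbourhood is (σθ^b + ρ)^{2w+1} ≤ (θ^a q)^{2w+1} with q < 1, so u is unhappy with
-- probability at most q^{2w}. The 2w sites whose neighbourhood wraps around the circle are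
-- counted trivially, and Markov's inequality bounds the count by n q^w with high probability.

module Submission where

open import Algebra.Bundles using (CommutativeRing)
open import Data.Bool as Bool using (Bool; true; false; not; _∧_; if_then_else_)
import Data.Bool.Properties as Bool
open import Data.Empty using (⊥-elim)
open import Data.Integer as ℤ using (ℤ)
import Data.Integer.Properties as ℤ
open import Data.List using (List; []; _∷_; _++_; length; filter; applyUpTo; take; drop; replicate; foldr; concatMap)
import Data.List.Properties as List
open import Data.Nat as ℕ using (ℕ; zero; suc; z≤n; s≤s; _≥_)
import Data.Nat.DivMod as ℕ
import Data.Nat.Properties as ℕ
import Data.Nat.Solver
open import Data.Product using (Σ; _×_; _,_; proj₁; proj₂; ∃)
open import Data.Rational hiding (_≥_; _>_)
open import Data.Rational.Properties
import Data.Rational.Unnormalised as ℚᵘ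
import Data.Rational.Unnormalised.Properties as ℚᵘ
open import Data.Rational.Solver using (module +-*-Solver)
open import Data.Sum using (inj₁; inj₂)
open import Relation.Binary.PropositionalEquality
open import Relation.Nullary using (¬_; Dec; yes; no)
open import Relation.Nullary.Decidable using (does; dec-true)

open import Defs

open +-*-Solver
module ℕ-Solver = Data.Nat.Solver.+-*-Solver

open CommutativeRing +-*-commutativeRing using (semiring)
import Algebra.Definitions.RawMonoid +-0-rawMonoid as Multiple
import Algebra.Properties.Monoid.Mult +-0-monoid as ×-Properties
import Algebra.Properties.Semiring.Mult semiring as ×-*-Properties

p≤q⇒0≤q-p : ∀ {p q} → p ≤ q → 0ℚ ≤ q - p
p≤q⇒0≤q-p {p} {q} p≤q = subst (_≤ q - p) (+-inverseʳ p) (+-monoˡ-≤ (- p) p≤q)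

p<q⇒0<q-p : ∀ {p q} → p < q → 0ℚ < q - p
p<q⇒0<q-p {p} {q} p<q = subst (_< q - p) (+-inverseʳ p) (+-monoˡ-< (- p) p<q)

0≤q-p⇒p≤q : ∀ {p q} → 0ℚ ≤ q - p → p ≤ q
0≤q-p⇒p≤q {p} {q} 0≤q-p = subst₂ _≤_ (+-identityʳ p) (solve 2 (λ p q → p :+ (q :- p) := q) refl p q) (+-monoʳ-≤ p 0≤q-p)

0<q-p⇒p<q : ∀ {p q} → 0ℚ < q - p → p < q
0<q-p⇒p<q {p} {q} 0<q-p = subst₂ _<_ (+-identityʳ p) (solve 2 (λ p q → p :+ (q :- p) := q) refl p q) (+-monoʳ-< p 0<q-p)

0≤1 : 0ℚ ≤ 1ℚ
0≤1 = <⇒≤ (positive⁻¹ 1ℚ)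

½<1 : ½ < 1ℚ
½<1 = *<* (ℤ.+<+ (s≤s (s≤s z≤n)))

+-nonNeg : ∀ {p q} → 0ℚ ≤ p → 0ℚ ≤ q → 0ℚ ≤ p + q
+-nonNeg = +-mono-≤

*-nonNeg : ∀ {p q} → 0ℚ ≤ p → 0ℚ ≤ q → 0ℚ ≤ p * q
*-nonNeg {p} {q} 0≤p 0≤q = nonNegative⁻¹ (p * q) {{nonNeg*nonNeg⇒nonNeg p {{nonNegative 0≤p}} q {{nonNegative 0≤q}}}}

*-pos : ∀ {p q} → 0ℚ < p → 0ℚ < q → 0ℚ < p * q
*-pos {p} {q} 0<p 0<q = positive⁻¹ (p * q) {{pos*pos⇒pos p {{positive 0<p}} q {{positive 0<q}}}}

*-monoˡ-≤ : ∀ {r p q} → 0ℚ ≤ r → p ≤ q → r * p ≤ r * q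
*-monoˡ-≤ {r} 0≤r = *-monoˡ-≤-nonNeg r {{nonNegative 0≤r}}

*-monoʳ-≤ : ∀ {r p q} → 0ℚ ≤ r → p ≤ q → p * r ≤ q * r
*-monoʳ-≤ {r} 0≤r = *-monoʳ-≤-nonNeg r {{nonNegative 0≤r}}

*-mono-≤ : ∀ {p q r s} → 0ℚ ≤ p → 0ℚ ≤ r → p ≤ q → r ≤ s → p * r ≤ q * s
*-mono-≤ 0≤p 0≤r p≤q r≤s = ≤-trans (*-monoˡ-≤ 0≤p r≤s) (*-monoʳ-≤ (≤-trans 0≤r r≤s) p≤q)

*-cancelˡ-≤ : ∀ {r p q} → 0ℚ < r → r * p ≤ r * q → p ≤ q
*-cancelˡ-≤ {r} 0<r = *-cancelˡ-≤-pos r {{positive 0<r}}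

^ℚ-nonNeg : ∀ {x} k → 0ℚ ≤ x → 0ℚ ≤ x ^ℚ k
^ℚ-nonNeg zero    0≤x = 0≤1
^ℚ-nonNeg (suc k) 0≤x = *-nonNeg 0≤x (^ℚ-nonNeg k 0≤x)

^ℚ-pos : ∀ {x} k → 0ℚ < x → 0ℚ < x ^ℚ k
^ℚ-pos zero    0<x = positive⁻¹ 1ℚ
^ℚ-pos (suc k) 0<x = *-pos 0<x (^ℚ-pos k 0<x)

^ℚ-monoˡ-≤ : ∀ {x y} k → 0ℚ ≤ x → x ≤ y → x ^ℚ k ≤ y ^ℚ k
^ℚ-monoˡ-≤ zero    0≤x x≤y = ≤-refl
^ℚ-monoˡ-≤ (suc k) 0≤x x≤y = *-mono-≤ 0≤x (^ℚ-nonNeg k 0≤x) x≤y (^ℚ-monoˡ-≤ k 0≤x x≤y)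

^ℚ-≤1 : ∀ {x} k → 0ℚ ≤ x → x ≤ 1ℚ → x ^ℚ k ≤ 1ℚ
^ℚ-≤1 {x} k 0≤x x≤1 = ≤-trans (^ℚ-monoˡ-≤ k 0≤x x≤1) (≤-reflexive (1^ℚ k))
  where
  1^ℚ : ∀ k → 1ℚ ^ℚ k ≡ 1ℚ
  1^ℚ zero    = refl
  1^ℚ (suc k) = trans (*-identityˡ _) (1^ℚ k)

^ℚ-homo-+ : ∀ x j k → x ^ℚ (j ℕ.+ k) ≡ x ^ℚ j * x ^ℚ k
^ℚ-homo-+ x zero    k = sym (*-identityˡ _)
^ℚ-homo-+ x (suc j) k = trans (cong (x *_) (^ℚ-homo-+ x j k)) (sym (*-assoc x _ _))

^ℚ-assoc : ∀ x j k → x ^ℚ (j ℕ.* k) ≡ (x ^ℚ k) ^ℚ j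
^ℚ-assoc x zero    k = refl
^ℚ-assoc x (suc j) k = trans (^ℚ-homo-+ x k (j ℕ.* k)) (cong (x ^ℚ k *_) (^ℚ-assoc x j k))

^ℚ-distrib-* : ∀ x y k → (x * y) ^ℚ k ≡ x ^ℚ k * y ^ℚ k
^ℚ-distrib-* x y zero    = refl
^ℚ-distrib-* x y (suc k) rewrite ^ℚ-distrib-* x y k =
  solve 4 (λ x y a b → (x :* y) :* (a :* b) := (x :* a) :* (y :* b)) refl x y (x ^ℚ k) (y ^ℚ k)

^ℚ-antimonoʳ-≤ : ∀ {x j k} → 0ℚ ≤ x → x ≤ 1ℚ → j ℕ.≤ k → x ^ℚ k ≤ x ^ℚ j
^ℚ-antimonoʳ-≤ {x} {j} {k} 0≤x x≤1 j≤k = begin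
  x ^ℚ k                    ≡⟨ cong (x ^ℚ_) (sym (ℕ.m+[n∸m]≡n j≤k)) ⟩
  x ^ℚ (j ℕ.+ (k ℕ.∸ j))    ≡⟨ ^ℚ-homo-+ x j (k ℕ.∸ j) ⟩
  x ^ℚ j * x ^ℚ (k ℕ.∸ j)   ≤⟨ *-monoˡ-≤ (^ℚ-nonNeg j 0≤x) (^ℚ-≤1 (k ℕ.∸ j) 0≤x x≤1) ⟩
  x ^ℚ j * 1ℚ               ≡⟨ *-identityʳ _ ⟩
  x ^ℚ j                    ∎
  where open ≤-Reasoning

toℚ : ℕ → ℚ
toℚ n = n Multiple.× 1ℚ

toℚ-+ : ∀ m n → toℚ (m ℕ.+ n) ≡ toℚ m + toℚ n
toℚ-+ = ×-Properties.×-homo-+ 1ℚ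

toℚ-* : ∀ m n → toℚ (m ℕ.* n) ≡ toℚ m * toℚ n
toℚ-* = ×-*-Properties.×1-homo-*

toℚ-1 : toℚ 1 ≡ 1ℚ
toℚ-1 = ×-Properties.×-homo-1 1ℚ

toℚ-nonNeg : ∀ n → 0ℚ ≤ toℚ n
toℚ-nonNeg zero    = ≤-refl
toℚ-nonNeg (suc n) = +-nonNeg 0≤1 (toℚ-nonNeg n)

toℚ-pos : ∀ n → 0ℚ < toℚ (suc n)
toℚ-pos n = +-mono-<-≤ (positive⁻¹ 1ℚ) (toℚ-nonNeg n)

0<toℚ : ∀ {n} → 1 ℕ.≤ n → 0ℚ < toℚ n
0<toℚ {suc n} _ = toℚ-pos n

toℚ-mono-≤ : ∀ {m n} → m ℕ.≤ n → toℚ m ≤ toℚ n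
toℚ-mono-≤ {m} {n} m≤n = begin
  toℚ m                        ≡⟨ sym (+-identityʳ (toℚ m)) ⟩
  toℚ m + 0ℚ                   ≤⟨ +-monoʳ-≤ (toℚ m) (toℚ-nonNeg (n ℕ.∸ m)) ⟩
  toℚ m + toℚ (n ℕ.∸ m)        ≡⟨ sym (toℚ-+ m (n ℕ.∸ m)) ⟩
  toℚ (m ℕ.+ (n ℕ.∸ m))        ≡⟨ cong toℚ (ℕ.m+[n∸m]≡n m≤n) ⟩
  toℚ n                        ∎
  where open ≤-Reasoning

toℚ-mono-< : ∀ {m n} → m ℕ.< n → toℚ m < toℚ n
toℚ-mono-< {m} {suc n} (s≤s m≤n) =
  <-≤-trans (subst (_< 1ℚ + toℚ m) (+-identityˡ (toℚ m)) (+-monoˡ-< (toℚ m) (positive⁻¹ 1ℚ)))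
            (+-monoʳ-≤ 1ℚ (toℚ-mono-≤ m≤n))

toℚ-cancel-< : ∀ {m n} → toℚ m < toℚ n → m ℕ.< n
toℚ-cancel-< {m} {n} toℚm<toℚn with ℕ.<-≤-connex m n
... | inj₁ m<n = m<n
... | inj₂ n≤m = ⊥-elim (<-irrefl refl (<-≤-trans toℚm<toℚn (toℚ-mono-≤ n≤m)))

toℚᵘ-toℚ : ∀ n → toℚᵘ (toℚ n) ℚᵘ.≃ ℚᵘ.mkℚᵘ (ℤ.+ n) 0
toℚᵘ-toℚ zero    = ℚᵘ.*≡* refl
toℚᵘ-toℚ (suc n) = ℚᵘ.≃-trans (toℚᵘ-homo-+ 1ℚ (toℚ n))
  (ℚᵘ.≃-trans (ℚᵘ.+-congʳ (toℚᵘ 1ℚ) (toℚᵘ-toℚ n)) (ℚᵘ.*≡* eq))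
  where
  eq : (ℤ.+ 1 ℤ.* ℤ.+ 1 ℤ.+ ℤ.+ n ℤ.* ℤ.+ 1) ℤ.* ℤ.+ 1 ≡ ℤ.+ suc n ℤ.* (ℤ.+ 1 ℤ.* ℤ.+ 1)
  eq = trans (ℤ.*-identityʳ _) (trans (cong (λ z → ℤ.+ 1 ℤ.+ z) (ℤ.*-identityʳ (ℤ.+ n))) (sym (ℤ.*-identityʳ _)))

ℕtoℚ≡toℚ : ∀ n → ℕtoℚ n ≡ toℚ n
ℕtoℚ≡toℚ n = trans (fromℚᵘ-cong (ℚᵘ.≃-sym (toℚᵘ-toℚ n))) (fromℚᵘ-toℚᵘ (toℚ n))

/-*-toℚ : ∀ m n → (ℤ.+ m / suc n) * toℚ (suc n) ≡ toℚ m
/-*-toℚ m n = toℚᵘ-injective (ℚᵘ.≃-trans (toℚᵘ-homo-* (ℤ.+ m / suc n) (toℚ (suc n)))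
  (ℚᵘ.≃-trans (ℚᵘ.*-cong (toℚᵘ-fromℚᵘ (ℚᵘ.mkℚᵘ (ℤ.+ m) n)) (toℚᵘ-toℚ (suc n)))
  (ℚᵘ.≃-trans (ℚᵘ.*≡* eq) (ℚᵘ.≃-sym (toℚᵘ-toℚ m)))))
  where
  eq : (ℤ.+ m ℤ.* ℤ.+ suc n) ℤ.* ℤ.+ 1 ≡ ℤ.+ m ℤ.* ℤ.+ (suc n ℕ.* 1)
  eq = trans (ℤ.*-identityʳ _) (cong (λ k → ℤ.+ m ℤ.* ℤ.+ k) (sym (ℕ.*-identityʳ (suc n))))

toℚ-^ : ∀ k w → toℚ (k ℕ.^ w) ≡ toℚ k ^ℚ w
toℚ-^ k zero    = toℚ-1
toℚ-^ k (suc w) = trans (toℚ-* k (k ℕ.^ w)) (cong (toℚ k *_) (toℚ-^ k w))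

archimedean : ∀ q → ∃ λ N → ∀ M → N ℕ.≤ M → q ≤ toℚ M
archimedean (mkℚ (ℤ.+ k) d _) = k , λ M k≤M →
  toℚᵘ-cancel-≤ (ℚᵘ.≤-respʳ-≃ (ℚᵘ.≃-sym (toℚᵘ-toℚ M)) (ℚᵘ.*≤* (k*1≤M*[1+d] k≤M)))
  where
  k*1≤M*[1+d] : ∀ {M} → k ℕ.≤ M → ℤ.+ k ℤ.* ℤ.+ 1 ℤ.≤ ℤ.+ M ℤ.* ℤ.+ suc d
  k*1≤M*[1+d] {M} k≤M = subst₂ ℤ._≤_ (ℤ.pos-* k 1) (ℤ.pos-* M (suc d))
    (ℤ.+≤+ (ℕ.*-mono-≤ k≤M (s≤s z≤n)))
archimedean (mkℚ ℤ.-[1+ k ] d _) = 0 , λ M _ → ≤-trans (<⇒≤ (negative⁻¹ _)) (toℚ-nonNeg M)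

eventually-≤-toℚ* : ∀ a c → 0ℚ < c → Σ ℕ λ N → ∀ M → N ℕ.≤ M → a ≤ toℚ M * c
eventually-≤-toℚ* a c 0<c = proj₁ a/c≤ , λ M N≤M → begin
  a                  ≡⟨ sym (*-identityʳ a) ⟩
  a * 1ℚ             ≡⟨ cong (a *_) (sym (*-inverseˡ c)) ⟩
  a * (1/ c * c)     ≡⟨ sym (*-assoc a (1/ c) c) ⟩
  a * 1/ c * c       ≤⟨ *-monoʳ-≤ (<⇒≤ 0<c) (proj₂ a/c≤ M N≤M) ⟩
  toℚ M * c          ∎
  where
  open ≤-Reasoning
  instance
    c≢0 : NonZero c
    c≢0 = pos⇒nonZero c {{positive 0<c}}
  a/c≤ : ∃ λ N → ∀ M → N ℕ.≤ M → a * 1/ c ≤ toℚ M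
  a/c≤ = archimedean (a * 1/ c)

positive-fraction : ∀ x → 0ℚ < x → Σ ℕ λ a → Σ ℕ λ d → x * toℚ (suc d) ≡ toℚ a
positive-fraction x@(mkℚ (ℤ.+ a) d _) _ = a , d , trans (cong (_* toℚ (suc d)) (sym (↥p/↧p≡p x))) (/-*-toℚ a d)
positive-fraction (mkℚ ℤ.-[1+ _ ] _ _) 0<x = ⊥-elim (<-asym 0<x (negative⁻¹ _))

fraction-between : ∀ {s t} → 0ℚ ≤ s → s < t →
  Σ ℕ λ a → Σ ℕ λ d → s * toℚ (suc d) < toℚ a × toℚ a < t * toℚ (suc d)
fraction-between {s} {t} 0≤s s<t = a , d , s*b<a , a<t*b
  where
  x : ℚ
  x = (s + t) * ½
  0<[t-s]/2 : 0ℚ < (t - s) * ½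
  0<[t-s]/2 = *-pos (p<q⇒0<q-p s<t) (positive⁻¹ ½)
  s<x : s < x
  s<x = 0<q-p⇒p<q (subst (0ℚ <_) (solve 2 (λ s t → (t :- s) :* con ½ := (s :+ t) :* con ½ :- s) refl s t) 0<[t-s]/2)
  x<t : x < t
  x<t = 0<q-p⇒p<q (subst (0ℚ <_) (solve 2 (λ s t → (t :- s) :* con ½ := t :- (s :+ t) :* con ½) refl s t) 0<[t-s]/2)
  fraction : Σ ℕ λ a → Σ ℕ λ d → x * toℚ (suc d) ≡ toℚ a
  fraction = positive-fraction x (≤-<-trans 0≤s s<x)
  a d : ℕ
  a = proj₁ fraction
  d = proj₁ (proj₂ fraction)
  b : ℚ
  b = toℚ (suc d)
  s*b<a : s * b < toℚ a
  s*b<a = subst (s * b <_) (proj₂ (proj₂ fraction)) (*-monoˡ-<-pos b {{positive (toℚ-pos d)}} s<x)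
  a<t*b : toℚ a < t * b
  a<t*b = subst (_< t * b) (proj₂ (proj₂ fraction)) (*-monoˡ-<-pos b {{positive (toℚ-pos d)}} x<t)

-- Bernoulli-type inequalities

1-nδ≤[1-δ]^n : ∀ {δ} n → 0ℚ ≤ δ → δ ≤ 1ℚ → 1ℚ - toℚ n * δ ≤ (1ℚ - δ) ^ℚ n
1-nδ≤[1-δ]^n {δ} zero    0≤δ δ≤1 = ≤-reflexive (solve 1 (λ d → con 1ℚ :- con 0ℚ :* d := con 1ℚ) refl δ)
1-nδ≤[1-δ]^n {δ} (suc n) 0≤δ δ≤1 =
  ≤-trans step (*-monoˡ-≤ (p≤q⇒0≤q-p δ≤1) (1-nδ≤[1-δ]^n n 0≤δ δ≤1))
  where
  step : 1ℚ - (1ℚ + toℚ n) * δ ≤ (1ℚ - δ) * (1ℚ - toℚ n * δ)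
  step = 0≤q-p⇒p≤q (subst (0ℚ ≤_)
    (solve 2 (λ n d → n :* d :* d := (con 1ℚ :- d) :* (con 1ℚ :- n :* d) :- (con 1ℚ :- (con 1ℚ :+ n) :* d)) refl (toℚ n) δ)
    (*-nonNeg (*-nonNeg (toℚ-nonNeg n) 0≤δ) 0≤δ))

[1-δ]^n≤1-nδ+n²δ² : ∀ {δ} n → 0ℚ ≤ δ → δ ≤ 1ℚ →
  (1ℚ - δ) ^ℚ n ≤ 1ℚ - toℚ n * δ + toℚ n * toℚ n * (δ * δ)
[1-δ]^n≤1-nδ+n²δ² {δ} zero 0≤δ δ≤1 =
  ≤-reflexive (solve 1 (λ d → con 1ℚ := con 1ℚ :- con 0ℚ :* d :+ con 0ℚ :* con 0ℚ :* (d :* d)) refl δ)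
[1-δ]^n≤1-nδ+n²δ² {δ} (suc n) 0≤δ δ≤1 =
  ≤-trans (*-monoˡ-≤ (p≤q⇒0≤q-p δ≤1) ([1-δ]^n≤1-nδ+n²δ² n 0≤δ δ≤1)) step
  where
  N : ℚ
  N = toℚ n
  step : (1ℚ - δ) * (1ℚ - N * δ + N * N * (δ * δ)) ≤ 1ℚ - (1ℚ + N) * δ + (1ℚ + N) * (1ℚ + N) * (δ * δ)
  step = 0≤q-p⇒p≤q (subst (0ℚ ≤_)
    (solve 2 (λ n d → (con 1ℚ :+ n) :* d :* d :+ n :* n :* d :* d :* d
                := con 1ℚ :- (con 1ℚ :+ n) :* d :+ (con 1ℚ :+ n) :* (con 1ℚ :+ n) :* (d :* d)
                   :- (con 1ℚ :- d) :* (con 1ℚ :- n :* d :+ n :* n :* (d :* d))) refl N δ)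
    (+-nonNeg (*-nonNeg (*-nonNeg (toℚ-nonNeg (suc n)) 0≤δ) 0≤δ)
              (*-nonNeg (*-nonNeg (*-nonNeg (*-nonNeg (toℚ-nonNeg n) (toℚ-nonNeg n)) 0≤δ) 0≤δ) 0≤δ)))

[1-δ]^n*[1+nδ]≤1 : ∀ {δ} n → 0ℚ ≤ δ → δ ≤ 1ℚ → (1ℚ - δ) ^ℚ n * (1ℚ + toℚ n * δ) ≤ 1ℚ
[1-δ]^n*[1+nδ]≤1 {δ} zero    0≤δ δ≤1 = ≤-reflexive (solve 1 (λ δ → con 1ℚ :* (con 1ℚ :+ con 0ℚ :* δ) := con 1ℚ) refl δ)
[1-δ]^n*[1+nδ]≤1 {δ} (suc n) 0≤δ δ≤1 = begin
  (1ℚ - δ) * X * (1ℚ + (1ℚ + N) * δ)      ≡⟨ solve 3 (λ x δ n → (con 1ℚ :- δ) :* x :* (con 1ℚ :+ (con 1ℚ :+ n) :* δ)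
                                                            := x :* ((con 1ℚ :- δ) :* (con 1ℚ :+ (con 1ℚ :+ n) :* δ))) refl X δ N ⟩
  X * ((1ℚ - δ) * (1ℚ + (1ℚ + N) * δ))    ≤⟨ *-monoˡ-≤ (^ℚ-nonNeg n (p≤q⇒0≤q-p δ≤1)) step ⟩
  X * (1ℚ + N * δ)                        ≤⟨ [1-δ]^n*[1+nδ]≤1 n 0≤δ δ≤1 ⟩
  1ℚ                                      ∎
  where
  open ≤-Reasoning
  N : ℚ
  N = toℚ n
  X : ℚ
  X = (1ℚ - δ) ^ℚ n
  step : (1ℚ - δ) * (1ℚ + (1ℚ + N) * δ) ≤ 1ℚ + N * δ
  step = 0≤q-p⇒p≤q (subst (0ℚ ≤_)
    (solve 2 (λ n δ → (con 1ℚ :+ n) :* δ :* δ := con 1ℚ :+ n :* δ :- (con 1ℚ :- δ) :* (con 1ℚ :+ (con 1ℚ :+ n) :* δ)) refl N δ)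
    (*-nonNeg (*-nonNeg (toℚ-nonNeg (suc n)) 0≤δ) 0≤δ))

[1-δ]^n≤ε : ∀ {δ ε} n → 0ℚ ≤ δ → δ ≤ 1ℚ → 0ℚ ≤ ε → 1ℚ ≤ toℚ n * δ * ε → (1ℚ - δ) ^ℚ n ≤ ε
[1-δ]^n≤ε {δ} {ε} n 0≤δ δ≤1 0≤ε 1≤nδε = begin
  X                          ≡⟨ sym (*-identityʳ X) ⟩
  X * 1ℚ                     ≤⟨ *-monoˡ-≤ 0≤X 1≤nδε ⟩
  X * (N * δ * ε)            ≡⟨ solve 4 (λ x n δ e → x :* (n :* δ :* e) := e :* (x :* (n :* δ))) refl X N δ ε ⟩
  ε * (X * (N * δ))          ≤⟨ *-monoˡ-≤ 0≤ε (≤-trans (*-monoˡ-≤ 0≤X nδ≤1+nδ) ([1-δ]^n*[1+nδ]≤1 n 0≤δ δ≤1)) ⟩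
  ε * 1ℚ                     ≡⟨ *-identityʳ ε ⟩
  ε                          ∎
  where
  open ≤-Reasoning
  X N : ℚ
  X = (1ℚ - δ) ^ℚ n
  N = toℚ n
  0≤X : 0ℚ ≤ X
  0≤X = ^ℚ-nonNeg n (p≤q⇒0≤q-p δ≤1)
  nδ≤1+nδ : N * δ ≤ 1ℚ + N * δ
  nδ≤1+nδ = subst (_≤ 1ℚ + N * δ) (+-identityˡ (N * δ)) (+-monoˡ-≤ (N * δ) 0≤1)

^ℚ-eventually-≤ : ∀ {q ε} → 0ℚ ≤ q → q < 1ℚ → 0ℚ < ε → Σ ℕ λ N → ∀ w → N ℕ.≤ w → q ^ℚ w ≤ ε
^ℚ-eventually-≤ {q} {ε} 0≤q q<1 0<ε = proj₁ bound , λ w N≤w → subst (λ x → x ^ℚ w ≤ ε) 1-[1-q]≡q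
  ([1-δ]^n≤ε w (<⇒≤ (p<q⇒0<q-p q<1)) 1-q≤1 (<⇒≤ 0<ε) (subst (1ℚ ≤_) (sym (*-assoc (toℚ w) (1ℚ - q) ε)) (proj₂ bound w N≤w)))
  where
  bound : Σ ℕ λ N → ∀ w → N ℕ.≤ w → 1ℚ ≤ toℚ w * ((1ℚ - q) * ε)
  bound = eventually-≤-toℚ* 1ℚ ((1ℚ - q) * ε) (*-pos (p<q⇒0<q-p q<1) 0<ε)
  1-[1-q]≡q : 1ℚ - (1ℚ - q) ≡ q
  1-[1-q]≡q = solve 1 (λ q → con 1ℚ :- (con 1ℚ :- q) := q) refl q
  1-q≤1 : 1ℚ - q ≤ 1ℚ
  1-q≤1 = 0≤q-p⇒p≤q (subst (0ℚ ≤_) (sym 1-[1-q]≡q) 0≤q)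

boolToℕ : Bool → ℕ
boolToℕ true  = 1
boolToℕ false = 0

count : (ℕ → Bool) → ℕ → ℕ
count P zero    = 0
count P (suc k) = boolToℕ (P 0) ℕ.+ count (λ j → P (suc j)) k

length-filter-applyUpTo : ∀ (P : ℕ → Bool) f k →
  length (filter (λ j → P j Bool.≟ true) (applyUpTo f k)) ≡ count (λ j → P (f j)) k
length-filter-applyUpTo P f zero = refl
length-filter-applyUpTo P f (suc k) with P (f 0)
... | true  = cong suc (length-filter-applyUpTo P (λ j → f (suc j)) k)
... | false = length-filter-applyUpTo P (λ j → f (suc j)) k

count-cong : ∀ k {P Q : ℕ → Bool} → (∀ j → j ℕ.< k → P j ≡ Q j) → count P k ≡ count Q k
count-cong zero    P≗Q = refl
count-cong (suc k) P≗Q =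
  cong₂ ℕ._+_ (cong boolToℕ (P≗Q 0 (s≤s z≤n))) (count-cong k (λ j j<k → P≗Q (suc j) (s≤s j<k)))

count-+ : ∀ a b P → count P (a ℕ.+ b) ≡ count P a ℕ.+ count (λ j → P (a ℕ.+ j)) b
count-+ zero    b P = refl
count-+ (suc a) b P =
  trans (cong (boolToℕ (P 0) ℕ.+_) (count-+ a b (λ j → P (suc j)))) (sym (ℕ.+-assoc (boolToℕ (P 0)) _ _))

count-≤ : ∀ k P → count P k ℕ.≤ k
count-≤ zero    P = z≤n
count-≤ (suc k) P = ℕ.+-mono-≤ (boolToℕ≤1 (P 0)) (count-≤ k (λ j → P (suc j)))
  where
  boolToℕ≤1 : ∀ b → boolToℕ b ℕ.≤ 1
  boolToℕ≤1 true  = s≤s z≤n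
  boolToℕ≤1 false = z≤n

count-pos : ∀ k P j → j ℕ.< k → P j ≡ true → 1 ℕ.≤ count P k
count-pos (suc k) P zero    _         Pj rewrite Pj = s≤s z≤n
count-pos (suc k) P (suc j) (s≤s j<k) Pj =
  ℕ.≤-trans (count-pos k (λ i → P (suc i)) j j<k Pj) (ℕ.m≤n+m _ (boolToℕ (P 0)))

count-≤-middle : ∀ w n P → count P n ℕ.≤ (w ℕ.+ w) ℕ.+ count (λ i → P (w ℕ.+ i)) (n ℕ.∸ (w ℕ.+ w))
count-≤-middle w n P with ℕ.≤-<-connex (w ℕ.+ w) n
... | inj₂ n<2w = ℕ.≤-trans (count-≤ n P) (ℕ.≤-trans (ℕ.<⇒≤ n<2w) (ℕ.m≤m+n (w ℕ.+ w) _))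
... | inj₁ 2w≤n = subst (λ n → count P n ℕ.≤ (w ℕ.+ w) ℕ.+ C) w+[k+w]≡n (begin
    count P (w ℕ.+ (k ℕ.+ w))                          ≡⟨ count-+ w (k ℕ.+ w) P ⟩
    count P w ℕ.+ count (λ j → P (w ℕ.+ j)) (k ℕ.+ w)  ≡⟨ cong (count P w ℕ.+_) (count-+ k w (λ j → P (w ℕ.+ j))) ⟩
    count P w ℕ.+ (C ℕ.+ count _ w)                    ≤⟨ ℕ.+-mono-≤ (count-≤ w P) (ℕ.+-monoʳ-≤ C (count-≤ w _)) ⟩
    w ℕ.+ (C ℕ.+ w)                                    ≡⟨ trans (cong (w ℕ.+_) (ℕ.+-comm C w)) (sym (ℕ.+-assoc w w C)) ⟩
    (w ℕ.+ w) ℕ.+ C                                    ∎)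
  where
  open ℕ.≤-Reasoning
  k C : ℕ
  k = n ℕ.∸ (w ℕ.+ w)
  C = count (λ i → P (w ℕ.+ i)) k
  w+[k+w]≡n : w ℕ.+ (k ℕ.+ w) ≡ n
  w+[k+w]≡n = trans (cong (w ℕ.+_) (ℕ.+-comm k w)) (trans (sym (ℕ.+-assoc w w k)) (ℕ.m+[n∸m]≡n 2w≤n))

<∸-middle : ∀ {w i n} → i ℕ.< n ℕ.∸ (w ℕ.+ w) → w ℕ.+ i ℕ.+ w ℕ.< n
<∸-middle {w} {i} {n} i<n∸2w = begin-strict
  w ℕ.+ i ℕ.+ w                ≡⟨ trans (ℕ.+-assoc w i w) (trans (cong (w ℕ.+_) (ℕ.+-comm i w)) (sym (ℕ.+-assoc w w i))) ⟩
  w ℕ.+ w ℕ.+ i                <⟨ ℕ.+-monoʳ-< (w ℕ.+ w) i<n∸2w ⟩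
  w ℕ.+ w ℕ.+ (n ℕ.∸ (w ℕ.+ w)) ≡⟨ ℕ.m+[n∸m]≡n (ℕ.<⇒≤ (ℕ.m∸n≢0⇒n<m {n} {w ℕ.+ w} (λ n∸2w≡0 → ℕ.n≮0 (subst (i ℕ.<_) n∸2w≡0 i<n∸2w)))) ⟩
  n                            ∎
  where open ℕ.≤-Reasoning

take-++ : ∀ {A : Set} (ys zs : List A) {n} → length ys ≡ n → take n (ys ++ zs) ≡ ys
take-++ []       zs refl = refl
take-++ (y ∷ ys) zs refl = cong (y ∷_) (take-++ ys zs refl)

drop-++ : ∀ {A : Set} (ys zs : List A) {n} → length ys ≡ n → drop n (ys ++ zs) ≡ zs
drop-++ []       zs refl = refl
drop-++ (y ∷ ys) zs refl = drop-++ ys zs refl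

take-++-≤ : ∀ {A : Set} (ys zs : List A) {n} → n ℕ.≤ length ys → take n (ys ++ zs) ≡ take n ys
take-++-≤ ys       zs {zero}  _         = refl
take-++-≤ (y ∷ ys) zs {suc n} (s≤s n≤) = cong (y ∷_) (take-++-≤ ys zs n≤)

drop-++-≤ : ∀ {A : Set} (ys zs : List A) {n} → n ℕ.≤ length ys → drop n (ys ++ zs) ≡ drop n ys ++ zs
drop-++-≤ ys       zs {zero}  _         = refl
drop-++-≤ (y ∷ ys) zs {suc n} (s≤s n≤) = drop-++-≤ ys zs n≤

nth-drop : ∀ a xs j → nth (drop a xs) j ≡ nth xs (a ℕ.+ j)
nth-drop zero    xs       j = refl
nth-drop (suc a) []       j = refl
nth-drop (suc a) (x ∷ xs) j = nth-drop a xs j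

nth-take : ∀ L xs {j} → j ℕ.< L → nth (take L xs) j ≡ nth xs j
nth-take (suc L) []       _         = refl
nth-take (suc L) (x ∷ xs) {zero}  _         = refl
nth-take (suc L) (x ∷ xs) {suc j} (s≤s j<L) = nth-take L xs j<L

nth-++ʳ : ∀ xs ys j → nth (xs ++ ys) (length xs ℕ.+ j) ≡ nth ys j
nth-++ʳ []       ys j = refl
nth-++ʳ (x ∷ xs) ys j = nth-++ʳ xs ys j

typeAt-+-multiple : ∀ xs m k → m ℕ.< length xs → typeAt xs (m ℕ.+ k ℕ.* length xs) ≡ nth xs m
typeAt-+-multiple (x ∷ xs) m k m<n =
  cong (nth (x ∷ xs)) (trans (ℕ.[m+kn]%n≡m%n m k (suc (length xs))) (ℕ.m<n⇒m%n≡m m<n))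

typeAt≡nth : ∀ xs k → k ℕ.< length xs → typeAt xs k ≡ nth xs k
typeAt≡nth xs k k<n = subst (λ i → typeAt xs i ≡ nth xs k) (ℕ.+-identityʳ k) (typeAt-+-multiple xs k 0 k<n)

αCount : List Bool → ℕ
αCount []           = 0
αCount (false ∷ xs) = suc (αCount xs)
αCount (true ∷ xs)  = αCount xs

count-sameB-α≡αCount : ∀ ys → count (λ j → sameB (nth ys j) false) (length ys) ≡ αCount ys
count-sameB-α≡αCount []           = refl
count-sameB-α≡αCount (true ∷ ys)  = count-sameB-α≡αCount ys
count-sameB-α≡αCount (false ∷ ys) = cong suc (count-sameB-α≡αCount ys)

-- Indicators, sums and expectations

𝟙 : Bool → ℚ
𝟙 b = if b then 1ℚ else 0ℚ

𝟙-nonNeg : ∀ b → 0ℚ ≤ 𝟙 b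
𝟙-nonNeg true  = 0≤1
𝟙-nonNeg false = ≤-refl

𝟙-not-does-*≤ : ∀ {A : Set} (a? : Dec A) z {S} → 0ℚ ≤ S → (¬ A → z ≤ S) → 𝟙 (not (does a?)) * z ≤ S
𝟙-not-does-*≤ (yes a) z 0≤S _     = subst (_≤ _) (sym (*-zeroˡ z)) 0≤S
𝟙-not-does-*≤ (no ¬a) z _   z≤S  = subst (_≤ _) (sym (*-identityˡ z)) (z≤S ¬a)

does⇒ : ∀ {A : Set} (a? : Dec A) → does a? ≡ true → A
does⇒ (yes a) _ = a

not-does⇒¬ : ∀ {A : Set} (a? : Dec A) → not (does a?) ≡ true → ¬ A
not-does⇒¬ (no ¬a) _ = ¬a

toℚ-boolToℕ : ∀ b → toℚ (boolToℕ b) ≡ 𝟙 b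
toℚ-boolToℕ true  = toℚ-1
toℚ-boolToℕ false = refl

sq : ℚ → ℚ
sq x = x * x

sq-nonNeg : ∀ x → 0ℚ ≤ sq x
sq-nonNeg x with ≤-total 0ℚ x
... | inj₁ 0≤x = *-nonNeg 0≤x 0≤x
... | inj₂ x≤0 = subst (0ℚ ≤_) (solve 1 (λ x → (:- x) :* (:- x) := x :* x) refl x)
                       (*-nonNeg (neg-antimono-≤ x≤0) (neg-antimono-≤ x≤0))

∑ : ℕ → (ℕ → ℚ) → ℚ
∑ zero    f = 0ℚ
∑ (suc k) f = f 0 + ∑ k (λ i → f (suc i))

toℚ-count : ∀ k P → toℚ (count P k) ≡ ∑ k (λ i → 𝟙 (P i))
toℚ-count zero    P = refl
toℚ-count (suc k) P = trans (toℚ-+ (boolToℕ (P 0)) (count (λ j → P (suc j)) k))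
  (cong₂ _+_ (toℚ-boolToℕ (P 0)) (toℚ-count k (λ j → P (suc j))))

∑-≤ : ∀ k f c → (∀ i → i ℕ.< k → f i ≤ c) → ∑ k f ≤ toℚ k * c
∑-≤ zero    f c f≤c = ≤-reflexive (sym (*-zeroˡ c))
∑-≤ (suc k) f c f≤c = ≤-trans
  (+-mono-≤ (f≤c 0 (s≤s z≤n)) (∑-≤ k (λ i → f (suc i)) c (λ i i<k → f≤c (suc i) (s≤s i<k))))
  (≤-reflexive (solve 2 (λ c k → c :+ k :* c := (con 1ℚ :+ k) :* c) refl c (toℚ k)))

module Bernoulli (ρ : ℚ) (0≤ρ : 0ℚ ≤ ρ) (ρ≤1 : ρ ≤ 1ℚ) where

  σ : ℚ
  σ = 1ℚ - ρ

  0≤σ : 0ℚ ≤ σ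
  0≤σ = p≤q⇒0≤q-p ρ≤1

  𝔼 : ℕ → (List Bool → ℚ) → ℚ
  𝔼 zero    f = f []
  𝔼 (suc n) f = 𝔼 n (λ xs → σ * f (false ∷ xs) + ρ * f (true ∷ xs))

  𝔼-cong : ∀ n {f g} → (∀ xs → length xs ≡ n → f xs ≡ g xs) → 𝔼 n f ≡ 𝔼 n g
  𝔼-cong zero    f≗g = f≗g [] refl
  𝔼-cong (suc n) f≗g = 𝔼-cong n λ xs l →
    cong₂ (λ a b → σ * a + ρ * b) (f≗g (false ∷ xs) (cong suc l)) (f≗g (true ∷ xs) (cong suc l))

  𝔼-mono : ∀ n {f g} → (∀ xs → length xs ≡ n → f xs ≤ g xs) → 𝔼 n f ≤ 𝔼 n g
  𝔼-mono zero    f≤g = f≤g [] refl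
  𝔼-mono (suc n) f≤g = 𝔼-mono n λ xs l →
    +-mono-≤ (*-monoˡ-≤ 0≤σ (f≤g (false ∷ xs) (cong suc l))) (*-monoˡ-≤ 0≤ρ (f≤g (true ∷ xs) (cong suc l)))

  𝔼-+ : ∀ n f g → 𝔼 n (λ xs → f xs + g xs) ≡ 𝔼 n f + 𝔼 n g
  𝔼-+ zero    f g = refl
  𝔼-+ (suc n) f g = trans
    (𝔼-cong n (λ xs _ → solve 6 (λ s r a b c d → s :* (a :+ b) :+ r :* (c :+ d) := (s :* a :+ r :* c) :+ (s :* b :+ r :* d))
                                  refl σ ρ (f (false ∷ xs)) (g (false ∷ xs)) (f (true ∷ xs)) (g (true ∷ xs))))
    (𝔼-+ n _ _)

  𝔼-*ˡ : ∀ n c f → 𝔼 n (λ xs → c * f xs) ≡ c * 𝔼 n f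
  𝔼-*ˡ zero    c f = refl
  𝔼-*ˡ (suc n) c f = trans
    (𝔼-cong n (λ xs _ → solve 5 (λ s r c a b → s :* (c :* a) :+ r :* (c :* b) := c :* (s :* a :+ r :* b))
                                  refl σ ρ c (f (false ∷ xs)) (f (true ∷ xs))))
    (𝔼-*ˡ n c _)

  𝔼-*ʳ : ∀ n c f → 𝔼 n (λ xs → f xs * c) ≡ 𝔼 n f * c
  𝔼-*ʳ n c f = trans (𝔼-cong n (λ xs _ → *-comm (f xs) c)) (trans (𝔼-*ˡ n c f) (*-comm c (𝔼 n f)))

  𝔼-const : ∀ n c → 𝔼 n (λ _ → c) ≡ c
  𝔼-const zero    c = refl
  𝔼-const (suc n) c = trans (𝔼-cong n (λ _ _ → solve 2 (λ r c → (con 1ℚ :- r) :* c :+ r :* c := c) refl ρ c)) (𝔼-const n c)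

  𝔼-nonNeg : ∀ n {f} → (∀ xs → length xs ≡ n → 0ℚ ≤ f xs) → 0ℚ ≤ 𝔼 n f
  𝔼-nonNeg n {f} 0≤f = subst (_≤ 𝔼 n f) (𝔼-const n 0ℚ) (𝔼-mono n 0≤f)

  𝔼-++ : ∀ a b f → 𝔼 (a ℕ.+ b) f ≡ 𝔼 b (λ zs → 𝔼 a (λ ys → f (ys ++ zs)))
  𝔼-++ zero    b f = refl
  𝔼-++ (suc a) b f = 𝔼-++ a b _

  𝔼-∑ : ∀ n k (f : ℕ → List Bool → ℚ) → 𝔼 n (λ xs → ∑ k (λ i → f i xs)) ≡ ∑ k (λ i → 𝔼 n (f i))
  𝔼-∑ n zero    f = 𝔼-const n 0ℚ
  𝔼-∑ n (suc k) f = trans (𝔼-+ n (f 0) _) (cong (𝔼 n (f 0) +_) (𝔼-∑ n k (λ i → f (suc i))))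

  markov : ∀ n (P : List Bool → Bool) c f → (∀ xs → length xs ≡ n → 𝟙 (P xs) * c ≤ f xs) →
           𝔼 n (λ xs → 𝟙 (P xs)) * c ≤ 𝔼 n f
  markov n P c f 𝟙c≤f = ≤-trans (≤-reflexive (sym (𝔼-*ʳ n c _))) (𝔼-mono n 𝟙c≤f)

  chebyshev : ∀ n (P : List Bool → Bool) (Y : List Bool → ℚ) μ K → 0ℚ ≤ K →
    (∀ xs → length xs ≡ n → P xs ≡ true → Y xs + K ≤ μ) →
    𝔼 n (λ xs → 𝟙 (P xs)) * (K * K) ≤ 𝔼 n (λ xs → sq (Y xs - μ))
  chebyshev n P Y μ K 0≤K Y+K≤μ = markov n P (K * K) (λ xs → sq (Y xs - μ)) pointwise
    where
    pointwise : ∀ xs → length xs ≡ n → 𝟙 (P xs) * (K * K) ≤ sq (Y xs - μ)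
    pointwise xs ∣xs∣≡n with P xs in Pxs
    ... | false = subst (_≤ sq (Y xs - μ)) (sym (*-zeroˡ (K * K))) (sq-nonNeg (Y xs - μ))
    ... | true  = begin
      1ℚ * (K * K)            ≡⟨ *-identityˡ (K * K) ⟩
      K * K                   ≤⟨ *-mono-≤ 0≤K 0≤K K≤μ-Y K≤μ-Y ⟩
      (μ - Y xs) * (μ - Y xs) ≡⟨ solve 2 (λ m y → (m :- y) :* (m :- y) := (y :- m) :* (y :- m)) refl μ (Y xs) ⟩
      sq (Y xs - μ)           ∎
      where
      open ≤-Reasoning
      K≤μ-Y : K ≤ μ - Y xs
      K≤μ-Y = 0≤q-p⇒p≤q (subst (0ℚ ≤_) (solve 3 (λ m y k → m :- (y :+ k) := (m :- y) :- k) refl μ (Y xs) K)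
                                   (p≤q⇒0≤q-p (Y+K≤μ xs ∣xs∣≡n Pxs)))

  union-bound : ∀ n (P Q : List Bool → Bool) →
    1ℚ - (𝔼 n (λ xs → 𝟙 (not (P xs))) + 𝔼 n (λ xs → 𝟙 (not (Q xs)))) ≤ 𝔼 n (λ xs → 𝟙 (P xs ∧ Q xs))
  union-bound n P Q = subst (1ℚ - (p̄ + q̄) ≤_) (solve 2 (λ c s → c :+ s :- s := c) refl pq (p̄ + q̄))
    (+-monoˡ-≤ (- (p̄ + q̄)) (begin
      1ℚ                                                                      ≡⟨ sym (𝔼-const n 1ℚ) ⟩
      𝔼 n (λ _ → 1ℚ)                                                          ≤⟨ 𝔼-mono n (λ xs _ → pointwise (P xs) (Q xs)) ⟩
      𝔼 n (λ xs → 𝟙 (P xs ∧ Q xs) + (𝟙 (not (P xs)) + 𝟙 (not (Q xs))))       ≡⟨ 𝔼-+ n _ _ ⟩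
      pq + 𝔼 n (λ xs → 𝟙 (not (P xs)) + 𝟙 (not (Q xs)))                       ≡⟨ cong (pq +_) (𝔼-+ n _ _) ⟩
      pq + (p̄ + q̄)                                                            ∎))
    where
    open ≤-Reasoning
    p̄ q̄ pq : ℚ
    p̄ = 𝔼 n (λ xs → 𝟙 (not (P xs)))
    q̄ = 𝔼 n (λ xs → 𝟙 (not (Q xs)))
    pq = 𝔼 n (λ xs → 𝟙 (P xs ∧ Q xs))
    pointwise : ∀ a b → 1ℚ ≤ 𝟙 (a ∧ b) + (𝟙 (not a) + 𝟙 (not b))
    pointwise true  true  = ≤-refl
    pointwise true  false = ≤-refl
    pointwise false true  = ≤-refl
    pointwise false false = 0≤q-p⇒p≤q 0≤1

  private
    ∑over : List (List Bool) → (List Bool → ℚ) → ℚ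
    ∑over xss g = foldr (λ xs acc → g xs + acc) 0ℚ xss

    ∑over-cong : ∀ xss {g h} → (∀ xs → g xs ≡ h xs) → ∑over xss g ≡ ∑over xss h
    ∑over-cong []        g≗h = refl
    ∑over-cong (xs ∷ xss) g≗h = cong₂ _+_ (g≗h xs) (∑over-cong xss g≗h)

    ∑over-extend : ∀ xss g → ∑over (concatMap (λ xs → (false ∷ xs) ∷ (true ∷ xs) ∷ []) xss) g
                               ≡ ∑over xss (λ xs → g (false ∷ xs) + g (true ∷ xs))
    ∑over-extend []         g = refl
    ∑over-extend (xs ∷ xss) g = trans (cong (λ t → g (false ∷ xs) + (g (true ∷ xs) + t)) (∑over-extend xss g))
                                      (sym (+-assoc (g (false ∷ xs)) _ _))

    countB≤length : ∀ xs → countB xs ℕ.≤ length xs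
    countB≤length []           = z≤n
    countB≤length (true ∷ xs)  = s≤s (countB≤length xs)
    countB≤length (false ∷ xs) = ℕ.m≤n⇒m≤1+n (countB≤length xs)

    weight-α∷ : ∀ xs → weight ρ (false ∷ xs) ≡ σ * weight ρ xs
    weight-α∷ xs = trans (cong (λ m → ρ ^ℚ countB xs * σ ^ℚ m) (ℕ.+-∸-assoc 1 (countB≤length xs)))
      (solve 3 (λ a s b → a :* (s :* b) := s :* (a :* b)) refl (ρ ^ℚ countB xs) σ (σ ^ℚ (length xs ℕ.∸ countB xs)))

    weight-β∷ : ∀ xs → weight ρ (true ∷ xs) ≡ ρ * weight ρ xs
    weight-β∷ xs = *-assoc ρ _ _

    ∑configs-weight≡𝔼 : ∀ n f → ∑over (configs n) (λ xs → weight ρ xs * f xs) ≡ 𝔼 n f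
    ∑configs-weight≡𝔼 zero    f = trans (+-identityʳ _) (*-identityˡ (f []))
    ∑configs-weight≡𝔼 (suc n) f = begin
      ∑over (configs (suc n)) (λ xs → weight ρ xs * f xs)                                 ≡⟨ ∑over-extend (configs n) (λ xs → weight ρ xs * f xs) ⟩
      ∑over (configs n) (λ xs → weight ρ (false ∷ xs) * f (false ∷ xs) + weight ρ (true ∷ xs) * f (true ∷ xs))
        ≡⟨ ∑over-cong (configs n) (λ xs → trans (cong₂ (λ a b → a * f (false ∷ xs) + b * f (true ∷ xs)) (weight-α∷ xs) (weight-β∷ xs))
             (solve 5 (λ s r w a b → s :* w :* a :+ r :* w :* b := w :* (s :* a :+ r :* b))
                      refl σ ρ (weight ρ xs) (f (false ∷ xs)) (f (true ∷ xs)))) ⟩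
      ∑over (configs n) (λ xs → weight ρ xs * (σ * f (false ∷ xs) + ρ * f (true ∷ xs)))   ≡⟨ ∑configs-weight≡𝔼 n _ ⟩
      𝔼 (suc n) f                                                                         ∎
      where open ≡-Reasoning

  Prob≡𝔼 : ∀ n P → Prob ρ n P ≡ 𝔼 n (λ xs → 𝟙 (P xs))
  Prob≡𝔼 n P = trans (∑over-cong (configs n) λ xs → if≡*𝟙 (P xs) (weight ρ xs)) (∑configs-weight≡𝔼 n _)
    where
    if≡*𝟙 : ∀ b x → (if b then x else 0ℚ) ≡ x * 𝟙 b
    if≡*𝟙 true  x = sym (*-identityʳ x)
    if≡*𝟙 false x = sym (*-zeroʳ x)

  𝔼-^αCount : ∀ n T → 𝔼 n (λ xs → T ^ℚ αCount xs) ≡ (σ * T + ρ) ^ℚ n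
  𝔼-^αCount zero    T = refl
  𝔼-^αCount (suc n) T = begin
    𝔼 n (λ xs → σ * (T * T ^ℚ αCount xs) + ρ * T ^ℚ αCount xs)  ≡⟨ 𝔼-cong n (λ xs _ → solve 4 (λ s r t x → s :* (t :* x) :+ r :* x := (s :* t :+ r) :* x)
                                                                                            refl σ ρ T (T ^ℚ αCount xs)) ⟩
    𝔼 n (λ xs → (σ * T + ρ) * T ^ℚ αCount xs)                   ≡⟨ 𝔼-*ˡ n (σ * T + ρ) _ ⟩
    (σ * T + ρ) * 𝔼 n (λ xs → T ^ℚ αCount xs)                   ≡⟨ cong ((σ * T + ρ) *_) (𝔼-^αCount n T) ⟩
    (σ * T + ρ) ^ℚ suc n                                        ∎
    where open ≡-Reasoning

  𝔼-window : ∀ o L r (g : List Bool → ℚ) → 𝔼 (o ℕ.+ (L ℕ.+ r)) (λ xs → g (take L (drop o xs))) ≡ 𝔼 L g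
  𝔼-window o L r g = begin
    𝔼 (o ℕ.+ (L ℕ.+ r)) (λ xs → g (take L (drop o xs)))                ≡⟨ 𝔼-++ o (L ℕ.+ r) _ ⟩
    𝔼 (L ℕ.+ r) (λ zs → 𝔼 o (λ ys → g (take L (drop o (ys ++ zs)))))   ≡⟨ 𝔼-cong (L ℕ.+ r) (λ zs _ →
                                                                            trans (𝔼-cong o (λ ys l → cong (λ t → g (take L t)) (drop-++ ys zs l)))
                                                                                  (𝔼-const o _)) ⟩
    𝔼 (L ℕ.+ r) (λ zs → g (take L zs))                                 ≡⟨ 𝔼-++ L r _ ⟩
    𝔼 r (λ vs → 𝔼 L (λ us → g (take L (us ++ vs))))                    ≡⟨ 𝔼-cong r (λ vs _ → 𝔼-cong L (λ us l → cong g (take-++ us vs l))) ⟩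
    𝔼 r (λ vs → 𝔼 L g)                                                 ≡⟨ 𝔼-const r _ ⟩
    𝔼 L g                                                              ∎
    where open ≡-Reasoning

  probOf : List Bool → ℚ
  probOf []          = 1ℚ
  probOf (false ∷ t) = σ * probOf t
  probOf (true ∷ t)  = ρ * probOf t

  𝔼-≡ : ∀ n t → length t ≡ n → 𝔼 n (λ ys → 𝟙 (does (List.≡-dec Bool._≟_ ys t))) ≡ probOf t
  𝔼-≡ zero    []          refl = refl
  𝔼-≡ (suc n) (false ∷ t) refl = trans
    (𝔼-cong n (λ xs _ → trans (cong (σ * 𝟙 (does (List.≡-dec Bool._≟_ xs t)) +_) (*-zeroʳ ρ)) (+-identityʳ _)))
    (trans (𝔼-*ˡ n σ _) (cong (σ *_) (𝔼-≡ n t refl)))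
  𝔼-≡ (suc n) (true ∷ t)  refl = trans
    (𝔼-cong n (λ xs _ → trans (cong (_+ ρ * 𝟙 (does (List.≡-dec Bool._≟_ xs t))) (*-zeroʳ σ)) (+-identityˡ _)))
    (trans (𝔼-*ˡ n ρ _) (cong (ρ *_) (𝔼-≡ n t refl)))

  probOf-++ : ∀ xs ys → probOf (xs ++ ys) ≡ probOf xs * probOf ys
  probOf-++ []          ys = sym (*-identityˡ _)
  probOf-++ (false ∷ xs) ys = trans (cong (σ *_) (probOf-++ xs ys)) (sym (*-assoc σ _ _))
  probOf-++ (true ∷ xs)  ys = trans (cong (ρ *_) (probOf-++ xs ys)) (sym (*-assoc ρ _ _))

  probOf-replicate-β : ∀ w → probOf (replicate w true) ≡ ρ ^ℚ w
  probOf-replicate-β zero    = refl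
  probOf-replicate-β (suc w) = cong (ρ *_) (probOf-replicate-β w)

-- Neighbourhoods and isolated α-nodes

nbhdSize : ℕ → ℕ
nbhdSize w = suc (w ℕ.+ w)

-- The neighbourhood of u as a sublist; it is the circular neighbourhood of Defs only when
-- w ≤ u and u + w < n, which is why the wrap-around sites are handled separately.
window : ℕ → List Bool → ℕ → List Bool
window w xs u = take (nbhdSize w) (drop (u ℕ.∸ w) xs)

∸+nbhdSize : ∀ {w u} → w ℕ.≤ u → (u ℕ.∸ w) ℕ.+ nbhdSize w ≡ suc (u ℕ.+ w)
∸+nbhdSize {w} {u} w≤u = trans (ℕ.+-suc (u ℕ.∸ w) (w ℕ.+ w))
  (cong suc (trans (sym (ℕ.+-assoc (u ℕ.∸ w) w w)) (cong (ℕ._+ w) (ℕ.m∸n+n≡m w≤u))))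

length-window : ∀ w xs u → w ℕ.≤ u → u ℕ.+ w ℕ.< length xs → length (window w xs u) ≡ nbhdSize w
length-window w xs u w≤u u+w<n = begin
  length (window w xs u)                          ≡⟨ List.length-take (nbhdSize w) (drop (u ℕ.∸ w) xs) ⟩
  nbhdSize w ℕ.⊓ length (drop (u ℕ.∸ w) xs)       ≡⟨ cong (nbhdSize w ℕ.⊓_) (List.length-drop (u ℕ.∸ w) xs) ⟩
  nbhdSize w ℕ.⊓ (length xs ℕ.∸ (u ℕ.∸ w))        ≡⟨ ℕ.m≤n⇒m⊓n≡m size≤rest ⟩
  nbhdSize w                                      ∎
  where
  open ≡-Reasoning
  size≤rest : nbhdSize w ℕ.≤ length xs ℕ.∸ (u ℕ.∸ w)
  size≤rest = subst (ℕ._≤ length xs ℕ.∸ (u ℕ.∸ w)) (ℕ.m+n∸m≡n (u ℕ.∸ w) (nbhdSize w))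
    (ℕ.∸-monoˡ-≤ (u ℕ.∸ w) (subst (ℕ._≤ length xs) (sym (∸+nbhdSize w≤u)) u+w<n))

sameCount≡count-window : ∀ xs w u → w ℕ.≤ u → u ℕ.+ w ℕ.< length xs →
  sameCount xs w u ≡ count (λ j → sameB (nth (window w xs u) j) (nth xs u)) (nbhdSize w)
sameCount≡count-window xs w u w≤u u+w<n =
  trans (length-filter-applyUpTo (λ j → sameB (typeAt xs ((u ℕ.+ n ℕ.* w ℕ.+ j) ℕ.∸ w)) (typeAt xs u)) (λ j → j) (nbhdSize w))
        (count-cong (nbhdSize w) λ j j<size → cong₂ sameB (site≡window j j<size) (typeAt≡nth xs u u<n))
  where
  n : ℕ
  n = length xs
  u<n : u ℕ.< n
  u<n = ℕ.≤-<-trans (ℕ.m≤m+n u w) u+w<n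
  site≡window : ∀ j → j ℕ.< nbhdSize w → typeAt xs ((u ℕ.+ n ℕ.* w ℕ.+ j) ℕ.∸ w) ≡ nth (window w xs u) j
  site≡window j (s≤s j≤2w) = begin
    typeAt xs ((u ℕ.+ n ℕ.* w ℕ.+ j) ℕ.∸ w)   ≡⟨ cong (typeAt xs) index≡ ⟩
    typeAt xs (v ℕ.+ j ℕ.+ w ℕ.* n)           ≡⟨ typeAt-+-multiple xs (v ℕ.+ j) w v+j<n ⟩
    nth xs (v ℕ.+ j)                          ≡⟨ sym (nth-drop v xs j) ⟩
    nth (drop v xs) j                         ≡⟨ sym (nth-take (nbhdSize w) (drop v xs) (s≤s j≤2w)) ⟩
    nth (window w xs u) j                     ∎
    where
    open ≡-Reasoning
    v : ℕ
    v = u ℕ.∸ w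
    index≡ : (u ℕ.+ n ℕ.* w ℕ.+ j) ℕ.∸ w ≡ v ℕ.+ j ℕ.+ w ℕ.* n
    index≡ = begin
      (u ℕ.+ n ℕ.* w ℕ.+ j) ℕ.∸ w          ≡⟨ cong (λ t → (t ℕ.+ n ℕ.* w ℕ.+ j) ℕ.∸ w) (sym (ℕ.m∸n+n≡m w≤u)) ⟩
      (v ℕ.+ w ℕ.+ n ℕ.* w ℕ.+ j) ℕ.∸ w    ≡⟨ cong (ℕ._∸ w) (ℕ-Solver.solve 4 (λ v w n j → v ⊕ w ⊕ n ⊛ w ⊕ j ⊜ (v ⊕ j ⊕ w ⊛ n) ⊕ w) refl v w n j) ⟩
      (v ℕ.+ j ℕ.+ w ℕ.* n ℕ.+ w) ℕ.∸ w    ≡⟨ ℕ.m+n∸n≡m _ w ⟩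
      v ℕ.+ j ℕ.+ w ℕ.* n                  ∎
      where open ℕ-Solver using () renaming (_:+_ to _⊕_; _:*_ to _⊛_; _:=_ to _⊜_)
    v+j<n : v ℕ.+ j ℕ.< n
    v+j<n = ℕ.≤-<-trans (ℕ.+-monoʳ-≤ v j≤2w)
      (subst (ℕ._< n) (sym (trans (sym (ℕ.+-assoc v w w)) (cong (ℕ._+ w) (ℕ.m∸n+n≡m w≤u)))) u+w<n)

sameCount-α≡αCount-window : ∀ xs w u → w ℕ.≤ u → u ℕ.+ w ℕ.< length xs → nth xs u ≡ false →
  sameCount xs w u ≡ αCount (window w xs u)
sameCount-α≡αCount-window xs w u w≤u u+w<n u-α = begin
  sameCount xs w u                                                                        ≡⟨ sameCount≡count-window xs w u w≤u u+w<n ⟩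
  count (λ j → sameB (nth (window w xs u) j) (nth xs u)) (nbhdSize w)                      ≡⟨ cong (λ b → count (λ j → sameB (nth (window w xs u) j) b) (nbhdSize w)) u-α ⟩
  count (λ j → sameB (nth (window w xs u) j) false) (nbhdSize w)                           ≡⟨ cong (count _) (sym (length-window w xs u w≤u u+w<n)) ⟩
  count (λ j → sameB (nth (window w xs u) j) false) (length (window w xs u))               ≡⟨ count-sameB-α≡αCount (window w xs u) ⟩
  αCount (window w xs u)                                                                  ∎
  where open ≡-Reasoning

1/nbhdSize<-eventually : ∀ {τ} → 0ℚ < τ → Σ ℕ λ N → ∀ w → N ℕ.≤ w → (ℤ.+ 1 / nbhdSize w) < τ
1/nbhdSize<-eventually {τ} 0<τ = proj₁ bound , λ w N≤w → *-cancelʳ-<-nonNeg (toℚ (nbhdSize w)) {{nonNegative (toℚ-nonNeg (nbhdSize w))}}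
  (subst (_< τ * toℚ (nbhdSize w)) (sym (trans (/-*-toℚ 1 (w ℕ.+ w)) toℚ-1)) (begin-strict
    1ℚ                       ≤⟨ proj₂ bound w N≤w ⟩
    toℚ w * τ                <⟨ *-monoˡ-<-pos τ {{positive 0<τ}} (toℚ-mono-< (s≤s (ℕ.m≤m+n w w))) ⟩
    toℚ (nbhdSize w) * τ     ≡⟨ *-comm _ τ ⟩
    τ * toℚ (nbhdSize w)     ∎))
  where
  open ≤-Reasoning
  bound : Σ ℕ λ N → ∀ w → N ℕ.≤ w → 1ℚ ≤ toℚ w * τ
  bound = eventually-≤-toℚ* 1ℚ τ 0<τ

isolatedα : ℕ → List Bool
isolatedα w = replicate w true ++ false ∷ replicate w true

length-isolatedα : ∀ w → length (isolatedα w) ≡ nbhdSize w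
length-isolatedα w = trans (List.length-++ (replicate w true))
  (trans (cong₂ ℕ._+_ (List.length-replicate w) (cong suc (List.length-replicate w))) (ℕ.+-suc w w))

αCount-isolatedα : ∀ w → αCount (isolatedα w) ≡ 1
αCount-isolatedα w = trans (αCount-β^k++ w) (cong suc (αCount-β^k w))
  where
  αCount-β^k++ : ∀ k {ys} → αCount (replicate k true ++ ys) ≡ αCount ys
  αCount-β^k++ zero    = refl
  αCount-β^k++ (suc k) = αCount-β^k++ k
  αCount-β^k : ∀ k → αCount (replicate k true) ≡ 0
  αCount-β^k zero    = refl
  αCount-β^k (suc k) = αCount-β^k k

isIsolatedα : ℕ → List Bool → Bool
isIsolatedα w ys = does (List.≡-dec Bool._≟_ ys (isolatedα w))

nth-isolatedα-centre : ∀ w → nth (isolatedα w) w ≡ false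
nth-isolatedα-centre w = subst (λ i → nth (isolatedα w) i ≡ false)
  (trans (ℕ.+-identityʳ _) (List.length-replicate w)) (nth-++ʳ (replicate w true) (false ∷ replicate w true) 0)

isolatedBlocks : ℕ → ℕ → List Bool → ℕ
isolatedBlocks w zero    xs = 0
isolatedBlocks w (suc m) xs = boolToℕ (isIsolatedα w (take (nbhdSize w) xs)) ℕ.+ isolatedBlocks w m (drop (nbhdSize w) xs)

blocks-fill : ∀ n L → 1 ℕ.≤ n ℕ./ suc L → n ℕ.≤ 2 ℕ.* (n ℕ./ suc L ℕ.* suc L)
blocks-fill n L 1≤m = begin
  n                                  ≡⟨ ℕ.m≡m%n+[m/n]*n n (suc L) ⟩
  n ℕ.% suc L ℕ.+ m ℕ.* suc L        ≤⟨ ℕ.+-monoˡ-≤ (m ℕ.* suc L) (ℕ.≤-trans (ℕ.m%n≤n n (suc L)) (ℕ.m≤n*m (suc L) m {{ℕ.>-nonZero 1≤m}})) ⟩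
  m ℕ.* suc L ℕ.+ m ℕ.* suc L        ≡⟨ cong (m ℕ.* suc L ℕ.+_) (sym (ℕ.+-identityʳ (m ℕ.* suc L))) ⟩
  2 ℕ.* (m ℕ.* suc L)                ∎
  where
  open ℕ.≤-Reasoning
  m : ℕ
  m = n ℕ./ suc L

isolatedProb : ℚ → ℕ → ℚ
isolatedProb ρ w = ρ ^ℚ w * ((1ℚ - ρ) * ρ ^ℚ w)

module Unhappiness (τ : ℚ) where

  -- Opaque so that goals mentioning it are not normalised into rational arithmetic.
  opaque
    unhappyα : List Bool → ℕ → ℕ → Bool
    unhappyα xs w u = not (typeAt xs u) ∧ unhappyB τ xs w u

  opaque
    unfolding unhappyα

    unhappyAlphaCount≡count : ∀ xs w → unhappyAlphaCount τ xs w ≡ count (unhappyα xs w) (length xs)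
    unhappyAlphaCount≡count xs w = length-filter-applyUpTo (unhappyα xs w) (λ j → j) (length xs)

    unhappyα-intro : ∀ xs w u → typeAt xs u ≡ false → unhappyB τ xs w u ≡ true → unhappyα xs w u ≡ true
    unhappyα-intro xs w u u-α u-unhappy = cong₂ _∧_ (cong not u-α) u-unhappy

    unhappyα-α : ∀ xs w u → unhappyα xs w u ≡ true → typeAt xs u ≡ false
    unhappyα-α xs w u unhappy = Bool.not-injective (Bool.∧-conicalˡ _ (unhappyB τ xs w u) unhappy)

    unhappyα-unhappy : ∀ xs w u → unhappyα xs w u ≡ true → unhappyB τ xs w u ≡ true
    unhappyα-unhappy xs w u unhappy = Bool.∧-conicalʳ (not (typeAt xs u)) (unhappyB τ xs w u) unhappy

  unhappyα⇒sparse-window : ∀ xs w u → w ℕ.≤ u → u ℕ.+ w ℕ.< length xs → unhappyα xs w u ≡ true →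
    (ℤ.+ αCount (window w xs u) / nbhdSize w) < τ
  unhappyα⇒sparse-window xs w u w≤u u+w<n unhappy =
    subst (λ s → (ℤ.+ s / nbhdSize w) < τ) (sameCount-α≡αCount-window xs w u w≤u u+w<n u-α)
          (does⇒ ((ℤ.+ sameCount xs w u / nbhdSize w) <? τ) (unhappyα-unhappy xs w u unhappy))
    where
    u-α : nth xs u ≡ false
    u-α = trans (sym (typeAt≡nth xs u (ℕ.≤-<-trans (ℕ.m≤m+n u w) u+w<n))) (unhappyα-α xs w u unhappy)

  atLeast atMost : ℚ → ℕ → ℕ → List Bool → Bool
  atLeast q n w xs = does (ℕtoℚ n * (q ^ℚ w) ≤? ℕtoℚ (unhappyAlphaCount τ xs w))
  atMost  q n w xs = does (ℕtoℚ (unhappyAlphaCount τ xs w) ≤? ℕtoℚ n * (q ^ℚ w))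

  isolatedα-centre-unhappy : ∀ w → (ℤ.+ 1 / nbhdSize w) < τ → ∀ xs o → o ℕ.+ nbhdSize w ℕ.≤ length xs →
    take (nbhdSize w) (drop o xs) ≡ isolatedα w → unhappyα xs w (o ℕ.+ w) ≡ true
  isolatedα-centre-unhappy w 1/size<τ xs o o+size≤n block≡ = unhappyα-intro xs w u u-α u-unhappy
    where
    u : ℕ
    u = o ℕ.+ w
    w≤u : w ℕ.≤ u
    w≤u = ℕ.m≤n+m w o
    u+w<n : u ℕ.+ w ℕ.< length xs
    u+w<n = subst (ℕ._≤ length xs) (trans (ℕ.+-suc o (w ℕ.+ w)) (cong suc (sym (ℕ.+-assoc o w w)))) o+size≤n
    window≡ : window w xs u ≡ isolatedα w
    window≡ = trans (cong (λ a → take (nbhdSize w) (drop a xs)) (ℕ.m+n∸n≡m o w)) block≡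
    nth-u : nth xs u ≡ false
    nth-u = begin
      nth xs (o ℕ.+ w)                         ≡⟨ sym (nth-drop o xs w) ⟩
      nth (drop o xs) w                        ≡⟨ sym (nth-take (nbhdSize w) (drop o xs) (s≤s (ℕ.m≤m+n w w))) ⟩
      nth (take (nbhdSize w) (drop o xs)) w    ≡⟨ cong (λ ys → nth ys w) block≡ ⟩
      nth (isolatedα w) w                      ≡⟨ nth-isolatedα-centre w ⟩
      false                                    ∎
      where open ≡-Reasoning
    u-α : typeAt xs u ≡ false
    u-α = trans (typeAt≡nth xs u (ℕ.≤-<-trans (ℕ.m≤m+n u w) u+w<n)) nth-u
    sameCount≡1 : sameCount xs w u ≡ 1
    sameCount≡1 = trans (sameCount-α≡αCount-window xs w u w≤u u+w<n nth-u)
                        (trans (cong αCount window≡) (αCount-isolatedα w))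
    u-unhappy : unhappyB τ xs w u ≡ true
    u-unhappy = dec-true ((ℤ.+ sameCount xs w u / nbhdSize w) <? τ)
                         (subst (λ s → (ℤ.+ s / nbhdSize w) < τ) (sym sameCount≡1) 1/size<τ)

  module _ (w : ℕ) (1/size<τ : (ℤ.+ 1 / nbhdSize w) < τ) where

    private
      L : ℕ
      L = nbhdSize w

    isolatedBlock≤unhappyα : ∀ xs o → o ℕ.+ L ℕ.≤ length xs →
      boolToℕ (isIsolatedα w (take L (drop o xs))) ℕ.≤ count (λ j → unhappyα xs w (o ℕ.+ j)) L
    isolatedBlock≤unhappyα xs o o+L≤n with List.≡-dec Bool._≟_ (take L (drop o xs)) (isolatedα w)
    ... | no  _      = z≤n
    ... | yes block≡ = count-pos L (λ j → unhappyα xs w (o ℕ.+ j)) w (s≤s (ℕ.m≤m+n w w))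
                                 (isolatedα-centre-unhappy w 1/size<τ xs o o+L≤n block≡)

    isolatedBlocks≤unhappyα-from : ∀ m o xs → o ℕ.+ m ℕ.* L ℕ.≤ length xs →
      isolatedBlocks w m (drop o xs) ℕ.≤ count (λ j → unhappyα xs w (o ℕ.+ j)) (m ℕ.* L)
    isolatedBlocks≤unhappyα-from zero    o xs _ = z≤n
    isolatedBlocks≤unhappyα-from (suc m) o xs o+[1+m]L≤n = begin
      boolToℕ (isIsolatedα w (take L (drop o xs))) ℕ.+ isolatedBlocks w m (drop L (drop o xs))
        ≡⟨ cong (λ ys → boolToℕ (isIsolatedα w (take L (drop o xs))) ℕ.+ isolatedBlocks w m ys) (List.drop-drop o L xs) ⟩
      boolToℕ (isIsolatedα w (take L (drop o xs))) ℕ.+ isolatedBlocks w m (drop (o ℕ.+ L) xs)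
        ≤⟨ ℕ.+-mono-≤ (isolatedBlock≤unhappyα xs o (ℕ.≤-trans (ℕ.+-monoʳ-≤ o (ℕ.m≤m+n L (m ℕ.* L))) o+[1+m]L≤n))
                      (isolatedBlocks≤unhappyα-from m (o ℕ.+ L) xs (subst (ℕ._≤ length xs) (sym (ℕ.+-assoc o L (m ℕ.* L))) o+[1+m]L≤n)) ⟩
      count (λ j → unhappyα xs w (o ℕ.+ j)) L ℕ.+ count (λ j → unhappyα xs w (o ℕ.+ L ℕ.+ j)) (m ℕ.* L)
        ≡⟨ cong (count (λ j → unhappyα xs w (o ℕ.+ j)) L ℕ.+_) (count-cong (m ℕ.* L) (λ j _ → cong (unhappyα xs w) (ℕ.+-assoc o L j))) ⟩
      count (λ j → unhappyα xs w (o ℕ.+ j)) L ℕ.+ count (λ j → unhappyα xs w (o ℕ.+ (L ℕ.+ j))) (m ℕ.* L)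
        ≡⟨ sym (count-+ L (m ℕ.* L) (λ j → unhappyα xs w (o ℕ.+ j))) ⟩
      count (λ j → unhappyα xs w (o ℕ.+ j)) (L ℕ.+ m ℕ.* L)
        ∎
      where open ℕ.≤-Reasoning

    isolatedBlocks≤unhappyAlphaCount : ∀ m xs → m ℕ.* L ℕ.≤ length xs →
      isolatedBlocks w m xs ℕ.≤ unhappyAlphaCount τ xs w
    isolatedBlocks≤unhappyAlphaCount m xs mL≤n = begin
      isolatedBlocks w m xs                                                  ≤⟨ isolatedBlocks≤unhappyα-from m 0 xs mL≤n ⟩
      count (unhappyα xs w) (m ℕ.* L)                                        ≤⟨ ℕ.m≤m+n _ _ ⟩
      count (unhappyα xs w) (m ℕ.* L) ℕ.+ count _ (length xs ℕ.∸ m ℕ.* L)    ≡⟨ sym (count-+ (m ℕ.* L) _ (unhappyα xs w)) ⟩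
      count (unhappyα xs w) (m ℕ.* L ℕ.+ (length xs ℕ.∸ m ℕ.* L))            ≡⟨ cong (count (unhappyα xs w)) (ℕ.m+[n∸m]≡n mL≤n) ⟩
      count (unhappyα xs w) (length xs)                                      ≡⟨ sym (unhappyAlphaCount≡count xs w) ⟩
      unhappyAlphaCount τ xs w                                               ∎
      where open ℕ.≤-Reasoning

module IsolatedBlockStatistics (ρ : ℚ) (0≤ρ : 0ℚ ≤ ρ) (ρ≤1 : ρ ≤ 1ℚ) where

  open Bernoulli ρ 0≤ρ ρ≤1

  𝔼-isIsolatedα : ∀ w → 𝔼 (nbhdSize w) (λ ys → 𝟙 (isIsolatedα w ys)) ≡ isolatedProb ρ w
  𝔼-isIsolatedα w = begin
    𝔼 (nbhdSize w) (λ ys → 𝟙 (isIsolatedα w ys))       ≡⟨ 𝔼-≡ (nbhdSize w) (isolatedα w) (length-isolatedα w) ⟩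
    probOf (isolatedα w)                               ≡⟨ probOf-++ (replicate w true) (false ∷ replicate w true) ⟩
    probOf (replicate w true) * (σ * probOf (replicate w true))
                                                       ≡⟨ cong₂ (λ a b → a * (σ * b)) (probOf-replicate-β w) (probOf-replicate-β w) ⟩
    isolatedProb ρ w                                     ∎
    where open ≡-Reasoning

  isolatedBlocks-++ : ∀ w m ys zs → length ys ≡ m ℕ.* nbhdSize w → isolatedBlocks w m (ys ++ zs) ≡ isolatedBlocks w m ys
  isolatedBlocks-++ w zero    ys zs _  = refl
  isolatedBlocks-++ w (suc m) ys zs ∣ys∣≡ = cong₂ ℕ._+_
    (cong (λ t → boolToℕ (isIsolatedα w t)) (take-++-≤ ys zs L≤∣ys∣))
    (trans (cong (isolatedBlocks w m) (drop-++-≤ ys zs L≤∣ys∣))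
           (isolatedBlocks-++ w m (drop L ys) zs
             (trans (List.length-drop L ys) (trans (cong (ℕ._∸ L) ∣ys∣≡) (ℕ.m+n∸m≡n L (m ℕ.* L))))))
    where
    L : ℕ
    L = nbhdSize w
    L≤∣ys∣ : L ℕ.≤ length ys
    L≤∣ys∣ = subst (L ℕ.≤_) (sym ∣ys∣≡) (ℕ.m≤m+n L (m ℕ.* L))

  isolatedBlocks-block-++ : ∀ w m ys zs → length ys ≡ nbhdSize w →
    isolatedBlocks w (suc m) (ys ++ zs) ≡ boolToℕ (isIsolatedα w ys) ℕ.+ isolatedBlocks w m zs
  isolatedBlocks-block-++ w m ys zs ∣ys∣≡ = cong₂ ℕ._+_
    (cong (λ t → boolToℕ (isIsolatedα w t)) (take-++ ys zs ∣ys∣≡)) (cong (isolatedBlocks w m) (drop-++ ys zs ∣ys∣≡))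

  𝔼-sq-𝟙+ : ∀ n (P : List Bool → Bool) c →
    𝔼 n (λ ys → sq (𝟙 (P ys) + c)) ≡ 𝔼 n (λ ys → 𝟙 (P ys)) * (1ℚ + (c + c)) + sq c
  𝔼-sq-𝟙+ n P c = begin
    𝔼 n (λ ys → sq (𝟙 (P ys) + c))                        ≡⟨ 𝔼-cong n (λ ys _ → sq-𝟙+ (P ys)) ⟩
    𝔼 n (λ ys → 𝟙 (P ys) * (1ℚ + (c + c)) + sq c)         ≡⟨ 𝔼-+ n _ _ ⟩
    𝔼 n (λ ys → 𝟙 (P ys) * (1ℚ + (c + c))) + 𝔼 n (λ _ → sq c)
                                                          ≡⟨ cong₂ _+_ (𝔼-*ʳ n (1ℚ + (c + c)) _) (𝔼-const n (sq c)) ⟩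
    𝔼 n (λ ys → 𝟙 (P ys)) * (1ℚ + (c + c)) + sq c         ∎
    where
    open ≡-Reasoning
    sq-𝟙+ : ∀ b → sq (𝟙 b + c) ≡ 𝟙 b * (1ℚ + (c + c)) + sq c
    sq-𝟙+ true  = solve 1 (λ c → (con 1ℚ :+ c) :* (con 1ℚ :+ c) := con 1ℚ :* (con 1ℚ :+ (c :+ c)) :+ c :* c) refl c
    sq-𝟙+ false = solve 1 (λ c → (con 0ℚ :+ c) :* (con 0ℚ :+ c) := con 0ℚ :* (con 1ℚ :+ (c :+ c)) :+ c :* c) refl c

  variance-isolatedBlocks : ∀ w m → let p = isolatedProb ρ w in
    𝔼 (m ℕ.* nbhdSize w) (λ xs → sq (toℚ (isolatedBlocks w m xs) - toℚ m * p)) ≡ toℚ m * (p * (1ℚ - p))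
  variance-isolatedBlocks w zero    = solve 1 (λ p → (con 0ℚ :- con 0ℚ :* p) :* (con 0ℚ :- con 0ℚ :* p) := con 0ℚ :* (p :* (con 1ℚ :- p))) refl (isolatedProb ρ w)
  variance-isolatedBlocks w (suc m) = begin
    𝔼 (L ℕ.+ m ℕ.* L) (λ xs → sq (toℚ (isolatedBlocks w (suc m) xs) - (1ℚ + M) * p))
      ≡⟨ 𝔼-++ L (m ℕ.* L) (λ xs → sq (toℚ (isolatedBlocks w (suc m) xs) - (1ℚ + M) * p)) ⟩
    𝔼 (m ℕ.* L) (λ zs → 𝔼 L (λ ys → sq (toℚ (isolatedBlocks w (suc m) (ys ++ zs)) - (1ℚ + M) * p)))
      ≡⟨ 𝔼-cong (m ℕ.* L) (λ zs _ → trans (𝔼-cong L (λ ys ∣ys∣≡ → cong sq (split ys zs ∣ys∣≡)))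
                                           (trans (𝔼-sq-𝟙+ L (isIsolatedα w) _)
                                                  (cong (λ e → e * (1ℚ + (D zs + D zs)) + sq (D zs)) (𝔼-isIsolatedα w)))) ⟩
    𝔼 (m ℕ.* L) (λ zs → p * (1ℚ + (D zs + D zs)) + sq (D zs))
      ≡⟨ 𝔼-cong (m ℕ.* L) (λ zs _ → solve 3 (λ p B m → p :* (con 1ℚ :+ ((B :- (con 1ℚ :+ m) :* p) :+ (B :- (con 1ℚ :+ m) :* p)))
                                                        :+ (B :- (con 1ℚ :+ m) :* p) :* (B :- (con 1ℚ :+ m) :* p)
                                                      := (B :- m :* p) :* (B :- m :* p) :+ p :* (con 1ℚ :- p))
                                             refl p (toℚ (isolatedBlocks w m zs)) M) ⟩
    𝔼 (m ℕ.* L) (λ zs → sq (toℚ (isolatedBlocks w m zs) - M * p) + p * (1ℚ - p))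
      ≡⟨ 𝔼-+ (m ℕ.* L) _ _ ⟩
    𝔼 (m ℕ.* L) (λ zs → sq (toℚ (isolatedBlocks w m zs) - M * p)) + 𝔼 (m ℕ.* L) (λ _ → p * (1ℚ - p))
      ≡⟨ cong₂ _+_ (variance-isolatedBlocks w m) (𝔼-const (m ℕ.* L) _) ⟩
    M * (p * (1ℚ - p)) + p * (1ℚ - p)
      ≡⟨ solve 2 (λ m q → m :* q :+ q := (con 1ℚ :+ m) :* q) refl M (p * (1ℚ - p)) ⟩
    (1ℚ + M) * (p * (1ℚ - p))
      ∎
    where
    open ≡-Reasoning
    L : ℕ
    L = nbhdSize w
    p M : ℚ
    p = isolatedProb ρ w
    M = toℚ m
    D : List Bool → ℚ
    D zs = toℚ (isolatedBlocks w m zs) - (1ℚ + M) * p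
    split : ∀ ys zs → length ys ≡ L →
      toℚ (isolatedBlocks w (suc m) (ys ++ zs)) - (1ℚ + M) * p ≡ 𝟙 (isIsolatedα w ys) + D zs
    split ys zs ∣ys∣≡ = begin
      toℚ (isolatedBlocks w (suc m) (ys ++ zs)) - (1ℚ + M) * p
        ≡⟨ cong (λ k → toℚ k - (1ℚ + M) * p) (isolatedBlocks-block-++ w m ys zs ∣ys∣≡) ⟩
      toℚ (boolToℕ (isIsolatedα w ys) ℕ.+ isolatedBlocks w m zs) - (1ℚ + M) * p
        ≡⟨ cong (_- (1ℚ + M) * p) (trans (toℚ-+ (boolToℕ (isIsolatedα w ys)) _)
             (cong (_+ toℚ (isolatedBlocks w m zs)) (toℚ-boolToℕ (isIsolatedα w ys)))) ⟩
      𝟙 (isIsolatedα w ys) + toℚ (isolatedBlocks w m zs) - (1ℚ + M) * p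
        ≡⟨ +-assoc (𝟙 (isIsolatedα w ys)) _ _ ⟩
      𝟙 (isIsolatedα w ys) + D zs
        ∎

  variance-isolatedBlocks-prefix : ∀ w m r → let p = isolatedProb ρ w in
    𝔼 (m ℕ.* nbhdSize w ℕ.+ r) (λ xs → sq (toℚ (isolatedBlocks w m xs) - toℚ m * p)) ≡ toℚ m * (p * (1ℚ - p))
  variance-isolatedBlocks-prefix w m r = begin
    𝔼 (m ℕ.* nbhdSize w ℕ.+ r) (λ xs → sq (toℚ (isolatedBlocks w m xs) - toℚ m * p))
      ≡⟨ 𝔼-++ (m ℕ.* nbhdSize w) r _ ⟩
    𝔼 r (λ zs → 𝔼 (m ℕ.* nbhdSize w) (λ ys → sq (toℚ (isolatedBlocks w m (ys ++ zs)) - toℚ m * p)))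
      ≡⟨ 𝔼-cong r (λ zs _ → 𝔼-cong (m ℕ.* nbhdSize w)
           (λ ys ∣ys∣≡ → cong (λ k → sq (toℚ k - toℚ m * p)) (isolatedBlocks-++ w m ys zs ∣ys∣≡))) ⟩
    𝔼 r (λ _ → 𝔼 (m ℕ.* nbhdSize w) (λ ys → sq (toℚ (isolatedBlocks w m ys) - toℚ m * p)))
      ≡⟨ 𝔼-const r _ ⟩
    𝔼 (m ℕ.* nbhdSize w) (λ ys → sq (toℚ (isolatedBlocks w m ys) - toℚ m * p))
      ≡⟨ variance-isolatedBlocks w m ⟩
    toℚ m * (p * (1ℚ - p))
      ∎
    where
    open ≡-Reasoning
    p : ℚ
    p = isolatedProb ρ w

-- The upper tail

-- For a < σb, θ = 1 - δ just below 1 makes the mean σθ^b + ρ of θ^{b·[site is α]} smaller than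
-- θ^a by a factor q < 1: by the Bernoulli inequalities θ^a - (σθ^b + ρ) ≥ δ(σb - a) - σb²δ²,
-- which is positive for δ = (σb - a)/(2b²).
module ExponentialTilt (ρ : ℚ) (0<ρ : 0ℚ < ρ) (ρ≤1 : ρ ≤ 1ℚ) (a d : ℕ)
                       (a<σb : toℚ a < (1ℚ - ρ) * toℚ (suc d)) where

  open Bernoulli ρ (<⇒≤ 0<ρ) ρ≤1 using (σ; 0≤σ)

  private
    b : ℕ
    b = suc d
    A B G : ℚ
    A = toℚ a
    B = toℚ b
    G = σ * B - A

    0<B : 0ℚ < B
    0<B = toℚ-pos d

    0<B*B : 0ℚ < B * B
    0<B*B = *-pos 0<B 0<B

    instance
      B*B≢0 : NonZero (B * B)
      B*B≢0 = pos⇒nonZero (B * B) {{positive 0<B*B}}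

    e : ℚ
    e = ½ * 1/ (B * B)

    B*B*e≡½ : B * B * e ≡ ½
    B*B*e≡½ = trans (solve 3 (λ x h y → x :* (h :* y) := h :* (x :* y)) refl (B * B) ½ (1/ (B * B)))
                    (trans (cong (½ *_) (*-inverseʳ (B * B))) (*-identityʳ ½))

    0<e : 0ℚ < e
    0<e = *-pos (positive⁻¹ ½) (positive⁻¹ (1/ (B * B)) {{1/pos⇒pos (B * B) {{positive 0<B*B}}}})

    δ : ℚ
    δ = G * e

    0<δ : 0ℚ < δ
    0<δ = *-pos (p<q⇒0<q-p a<σb) 0<e

    δ≤½ : δ ≤ ½
    δ≤½ = begin
      G * e        ≤⟨ *-monoʳ-≤ (<⇒≤ 0<e) G≤B ⟩
      B * e        ≡⟨ sym (*-identityˡ (B * e)) ⟩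
      1ℚ * (B * e) ≤⟨ *-monoʳ-≤ (*-nonNeg (<⇒≤ 0<B) (<⇒≤ 0<e)) 1≤B ⟩
      B * (B * e)  ≡⟨ trans (sym (*-assoc B B e)) B*B*e≡½ ⟩
      ½            ∎
      where
      open ≤-Reasoning
      G≤B : G ≤ B
      G≤B = 0≤q-p⇒p≤q (subst (0ℚ ≤_) (solve 3 (λ r b a → r :* b :+ a := b :- ((con 1ℚ :- r) :* b :- a)) refl ρ B A)
                                    (+-nonNeg (*-nonNeg (<⇒≤ 0<ρ) (toℚ-nonNeg b)) (toℚ-nonNeg a)))
      1≤B : 1ℚ ≤ B
      1≤B = subst (_≤ B) (+-identityʳ 1ℚ) (+-monoʳ-≤ 1ℚ (toℚ-nonNeg d))

    0≤δ : 0ℚ ≤ δ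
    0≤δ = <⇒≤ 0<δ

    σ<1 : σ < 1ℚ
    σ<1 = 0<q-p⇒p<q (subst (0ℚ <_) (solve 1 (λ r → r := con 1ℚ :- (con 1ℚ :- r)) refl ρ) 0<ρ)

    δ≤1 : δ ≤ 1ℚ
    δ≤1 = ≤-trans δ≤½ (<⇒≤ ½<1)

  θ : ℚ
  θ = 1ℚ - δ

  0<θ : 0ℚ < θ
  0<θ = p<q⇒0<q-p (≤-<-trans δ≤½ ½<1)

  θ≤1 : θ ≤ 1ℚ
  θ≤1 = 0≤q-p⇒p≤q (subst (0ℚ ≤_) (solve 1 (λ d → d := con 1ℚ :- (con 1ℚ :- d)) refl δ) 0≤δ)

  private
    0≤θ : 0ℚ ≤ θ
    0≤θ = <⇒≤ 0<θ

    tiltedMean : ℚ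
    tiltedMean = σ * θ ^ℚ b + ρ

    gain : ℚ
    gain = θ ^ℚ a - tiltedMean

    0<gain : 0ℚ < gain
    0<gain = <-≤-trans 0<lower lower≤gain
      where
      lower : ℚ
      lower = (1ℚ - A * δ) - (σ * (1ℚ - B * δ + B * B * (δ * δ)) + ρ)
      lower≤gain : lower ≤ gain
      lower≤gain = +-mono-≤ (1-nδ≤[1-δ]^n a 0≤δ δ≤1)
        (neg-antimono-≤ (+-monoˡ-≤ ρ (*-monoˡ-≤ 0≤σ ([1-δ]^n≤1-nδ+n²δ² b 0≤δ δ≤1))))
      lower≡ : lower ≡ δ * G * (1ℚ - σ * (B * B * e))
      lower≡ = solve 4 (λ r B A e → let s = con 1ℚ :- r ; g = s :* B :- A ; d = g :* e in
        (con 1ℚ :- A :* d) :- (s :* (con 1ℚ :- B :* d :+ B :* B :* (d :* d)) :+ r) := d :* g :* (con 1ℚ :- s :* (B :* B :* e)))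
        refl ρ B A e
      0<1-σ/2 : 0ℚ < 1ℚ - σ * (B * B * e)
      0<1-σ/2 = subst (λ t → 0ℚ < 1ℚ - σ * t) (sym B*B*e≡½) (p<q⇒0<q-p (≤-<-trans σ/2≤½ ½<1))
        where
        σ/2≤½ : σ * ½ ≤ ½
        σ/2≤½ = subst (σ * ½ ≤_) (*-identityˡ ½) (*-monoʳ-≤ (<⇒≤ (positive⁻¹ ½)) (<⇒≤ σ<1))
      0<lower : 0ℚ < lower
      0<lower = subst (0ℚ <_) (sym lower≡) (*-pos (*-pos 0<δ (p<q⇒0<q-p a<σb)) 0<1-σ/2)

  q : ℚ
  q = 1ℚ - gain

  q<1 : q < 1ℚ
  q<1 = 0<q-p⇒p<q (subst (0ℚ <_) (solve 1 (λ g → g := con 1ℚ :- (con 1ℚ :- g)) refl gain) 0<gain)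

  0<q : 0ℚ < q
  0<q = p<q⇒0<q-p (≤-<-trans gain≤σ σ<1)
    where
    gain≤σ : gain ≤ σ
    gain≤σ = 0≤q-p⇒p≤q (subst (0ℚ ≤_)
      (solve 4 (λ t s u r → (con 1ℚ :- t) :+ s :* u := (con 1ℚ :- r) :- (t :- (s :* u :+ r))) refl (θ ^ℚ a) σ (θ ^ℚ b) ρ)
      (+-nonNeg (p≤q⇒0≤q-p (^ℚ-≤1 a 0≤θ θ≤1)) (*-nonNeg 0≤σ (^ℚ-nonNeg b 0≤θ))))

  tiltedMean≤θ^a*q : σ * θ ^ℚ b + ρ ≤ θ ^ℚ a * q
  tiltedMean≤θ^a*q = 0≤q-p⇒p≤q (subst (0ℚ ≤_)
    (solve 2 (λ t m → (t :- m) :* (con 1ℚ :- t) := t :* (con 1ℚ :- (t :- m)) :- m) refl (θ ^ℚ a) tiltedMean)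
    (*-nonNeg (<⇒≤ 0<gain) (p≤q⇒0≤q-p (^ℚ-≤1 a 0≤θ θ≤1))))

module UpperTail (ρ τ : ℚ) (0<ρ : 0ℚ < ρ) (ρ≤1 : ρ ≤ 1ℚ) (a d : ℕ)
                 (τb<a : τ * toℚ (suc d) < toℚ a) (a<σb : toℚ a < (1ℚ - ρ) * toℚ (suc d)) where

  open Bernoulli ρ (<⇒≤ 0<ρ) ρ≤1
  open Unhappiness τ
  open ExponentialTilt ρ 0<ρ ρ≤1 a d a<σb

  private
    b : ℕ
    b = suc d

    0≤θ : 0ℚ ≤ θ
    0≤θ = <⇒≤ 0<θ

  sparse⇒θ^aL≤θ^bc : ∀ w c → (ℤ.+ c / nbhdSize w) < τ → (θ ^ℚ a) ^ℚ nbhdSize w ≤ (θ ^ℚ b) ^ℚ c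
  sparse⇒θ^aL≤θ^bc w c c/L<τ = subst₂ _≤_ (^ℚ-assoc θ L a) (^ℚ-assoc θ c b)
    (^ℚ-antimonoʳ-≤ {j = c ℕ.* b} {k = L ℕ.* a} 0≤θ θ≤1 (ℕ.<⇒≤ (toℚ-cancel-< (subst₂ _<_ (sym (toℚ-* c b)) (sym (toℚ-* L a)) cb<La))))
    where
    L : ℕ
    L = nbhdSize w
    c<τL : toℚ c < τ * toℚ L
    c<τL = subst (_< τ * toℚ L) (/-*-toℚ c (w ℕ.+ w)) (*-monoˡ-<-pos (toℚ L) {{positive (toℚ-pos (w ℕ.+ w))}} c/L<τ)
    cb<La : toℚ c * toℚ b < toℚ L * toℚ a
    cb<La = begin-strict
      toℚ c * toℚ b          <⟨ *-monoˡ-<-pos (toℚ b) {{positive (toℚ-pos d)}} c<τL ⟩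
      τ * toℚ L * toℚ b      ≡⟨ solve 3 (λ t l b → t :* l :* b := l :* (t :* b)) refl τ (toℚ L) (toℚ b) ⟩
      toℚ L * (τ * toℚ b)    ≤⟨ *-monoˡ-≤ (toℚ-nonNeg L) (<⇒≤ τb<a) ⟩
      toℚ L * toℚ a          ∎
      where open ≤-Reasoning

  ℙ-unhappyα≤ : ∀ w n u → w ℕ.≤ u → u ℕ.+ w ℕ.< n → 𝔼 n (λ xs → 𝟙 (unhappyα xs w u)) ≤ q ^ℚ w * q ^ℚ w
  ℙ-unhappyα≤ w n u w≤u u+w<n = begin
    ℙunhappy                      ≤⟨ *-cancelˡ-≤ (^ℚ-pos L (^ℚ-pos a 0<θ)) (≤-trans (≤-reflexive (*-comm _ ℙunhappy)) chernoff) ⟩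
    q ^ℚ L                        ≤⟨ ^ℚ-antimonoʳ-≤ (<⇒≤ 0<q) (<⇒≤ q<1) (ℕ.n≤1+n (w ℕ.+ w)) ⟩
    q ^ℚ (w ℕ.+ w)                ≡⟨ ^ℚ-homo-+ q w w ⟩
    q ^ℚ w * q ^ℚ w               ∎
    where
    open ≤-Reasoning
    L r : ℕ
    L = nbhdSize w
    r = n ℕ.∸ suc (u ℕ.+ w)
    ℙunhappy : ℚ
    ℙunhappy = 𝔼 n (λ xs → 𝟙 (unhappyα xs w u))
    n≡ : (u ℕ.∸ w) ℕ.+ (L ℕ.+ r) ≡ n
    n≡ = trans (sym (ℕ.+-assoc (u ℕ.∸ w) L r))
               (trans (cong (ℕ._+ r) (∸+nbhdSize w≤u)) (ℕ.m+[n∸m]≡n u+w<n))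
    θ^aL*𝟙≤θ^bαCount : ∀ xs → length xs ≡ n → 𝟙 (unhappyα xs w u) * (θ ^ℚ a) ^ℚ L ≤ (θ ^ℚ b) ^ℚ αCount (window w xs u)
    θ^aL*𝟙≤θ^bαCount xs ∣xs∣≡n with unhappyα xs w u in unhappy
    ... | true  = subst (_≤ (θ ^ℚ b) ^ℚ αCount (window w xs u)) (sym (*-identityˡ _))
                    (sparse⇒θ^aL≤θ^bc w (αCount (window w xs u)) (unhappyα⇒sparse-window xs w u w≤u (subst (u ℕ.+ w ℕ.<_) (sym ∣xs∣≡n) u+w<n) unhappy))
    ... | false = subst (_≤ (θ ^ℚ b) ^ℚ αCount (window w xs u)) (sym (*-zeroˡ ((θ ^ℚ a) ^ℚ L)))
                        (^ℚ-nonNeg (αCount (window w xs u)) (^ℚ-nonNeg b 0≤θ))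
    chernoff : ℙunhappy * (θ ^ℚ a) ^ℚ L ≤ (θ ^ℚ a) ^ℚ L * q ^ℚ L
    chernoff = begin
      ℙunhappy * (θ ^ℚ a) ^ℚ L                             ≤⟨ markov n (λ xs → unhappyα xs w u) _ _ θ^aL*𝟙≤θ^bαCount ⟩
      𝔼 n (λ xs → (θ ^ℚ b) ^ℚ αCount (window w xs u))      ≡⟨ cong (λ k → 𝔼 k (λ xs → (θ ^ℚ b) ^ℚ αCount (take L (drop (u ℕ.∸ w) xs)))) (sym n≡) ⟩
      𝔼 ((u ℕ.∸ w) ℕ.+ (L ℕ.+ r)) (λ xs → (θ ^ℚ b) ^ℚ αCount (take L (drop (u ℕ.∸ w) xs)))
                                                           ≡⟨ 𝔼-window (u ℕ.∸ w) L r (λ ys → (θ ^ℚ b) ^ℚ αCount ys) ⟩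
      𝔼 L (λ ys → (θ ^ℚ b) ^ℚ αCount ys)                   ≡⟨ 𝔼-^αCount L (θ ^ℚ b) ⟩
      (σ * θ ^ℚ b + ρ) ^ℚ L                                ≤⟨ ^ℚ-monoˡ-≤ L (+-nonNeg (*-nonNeg 0≤σ (^ℚ-nonNeg b 0≤θ)) (<⇒≤ 0<ρ)) tiltedMean≤θ^a*q ⟩
      (θ ^ℚ a * q) ^ℚ L                                    ≡⟨ ^ℚ-distrib-* (θ ^ℚ a) q L ⟩
      (θ ^ℚ a) ^ℚ L * q ^ℚ L                               ∎

  𝔼-unhappyAlphaCount≤ : ∀ w n → 𝔼 n (λ xs → toℚ (unhappyAlphaCount τ xs w)) ≤ toℚ (w ℕ.+ w) + toℚ n * (q ^ℚ w * q ^ℚ w)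
  𝔼-unhappyAlphaCount≤ w n = begin
    𝔼 n (λ xs → toℚ (unhappyAlphaCount τ xs w))                ≤⟨ 𝔼-mono n count≤border+middle ⟩
    𝔼 n (λ xs → toℚ (w ℕ.+ w) + ∑ k (λ i → 𝟙 (middle i xs)))   ≡⟨ 𝔼-+ n _ _ ⟩
    𝔼 n (λ _ → toℚ (w ℕ.+ w)) + 𝔼 n (λ xs → ∑ k (λ i → 𝟙 (middle i xs)))
                                                               ≡⟨ cong₂ _+_ (𝔼-const n _) (𝔼-∑ n k (λ i xs → 𝟙 (middle i xs))) ⟩
    toℚ (w ℕ.+ w) + ∑ k (λ i → 𝔼 n (λ xs → 𝟙 (middle i xs)))  ≤⟨ +-monoʳ-≤ (toℚ (w ℕ.+ w)) (∑-≤ k _ _ (λ i i<k → ℙ-unhappyα≤ w n (w ℕ.+ i) (ℕ.m≤m+n w i) (<∸-middle {w} i<k))) ⟩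
    toℚ (w ℕ.+ w) + toℚ k * (q ^ℚ w * q ^ℚ w)                   ≤⟨ +-monoʳ-≤ (toℚ (w ℕ.+ w)) (*-monoʳ-≤ (*-nonNeg 0≤q^w 0≤q^w) (toℚ-mono-≤ (ℕ.m∸n≤m n (w ℕ.+ w)))) ⟩
    toℚ (w ℕ.+ w) + toℚ n * (q ^ℚ w * q ^ℚ w)                   ∎
    where
    open ≤-Reasoning
    k : ℕ
    k = n ℕ.∸ (w ℕ.+ w)
    0≤q^w : 0ℚ ≤ q ^ℚ w
    0≤q^w = ^ℚ-nonNeg w (<⇒≤ 0<q)
    middle : ℕ → List Bool → Bool
    middle i xs = unhappyα xs w (w ℕ.+ i)
    count≤border+middle : ∀ xs → length xs ≡ n → toℚ (unhappyAlphaCount τ xs w) ≤ toℚ (w ℕ.+ w) + ∑ k (λ i → 𝟙 (middle i xs))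
    count≤border+middle xs refl = begin
      toℚ (unhappyAlphaCount τ xs w)                                   ≡⟨ cong toℚ (unhappyAlphaCount≡count xs w) ⟩
      toℚ (count (unhappyα xs w) (length xs))                          ≤⟨ toℚ-mono-≤ (count-≤-middle w (length xs) (unhappyα xs w)) ⟩
      toℚ ((w ℕ.+ w) ℕ.+ count (λ i → middle i xs) k)                  ≡⟨ trans (toℚ-+ (w ℕ.+ w) _) (cong (toℚ (w ℕ.+ w) +_) (toℚ-count k _)) ⟩
      toℚ (w ℕ.+ w) + ∑ k (λ i → 𝟙 (middle i xs))                      ∎

  ℙ-not-atMost≤ : ∀ w n ε → 1 ℕ.≤ n → q ^ℚ w ≤ ε * ½ * ½ → toℚ (w ℕ.+ w) ≤ toℚ n * q ^ℚ w * (ε * ½ * ½) →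
    𝔼 n (λ xs → 𝟙 (not (atMost q n w xs))) ≤ ε * ½
  ℙ-not-atMost≤ w n ε 1≤n q^w≤ε/4 2w≤Tε/4 = *-cancelˡ-≤ 0<T (begin
    T * ℙ                                         ≡⟨ *-comm T ℙ ⟩
    ℙ * T                                         ≤⟨ markov n (λ xs → not (atMost q n w xs)) T (λ xs → toℚ (unhappyAlphaCount τ xs w)) 𝟙*T≤count ⟩
    𝔼 n (λ xs → toℚ (unhappyAlphaCount τ xs w))   ≤⟨ 𝔼-unhappyAlphaCount≤ w n ⟩
    toℚ (w ℕ.+ w) + toℚ n * (q ^ℚ w * q ^ℚ w)     ≡⟨ cong (toℚ (w ℕ.+ w) +_) (sym (*-assoc (toℚ n) (q ^ℚ w) (q ^ℚ w))) ⟩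
    toℚ (w ℕ.+ w) + T * q ^ℚ w                    ≤⟨ +-mono-≤ 2w≤Tε/4 (*-monoˡ-≤ (<⇒≤ 0<T) q^w≤ε/4) ⟩
    T * (ε * ½ * ½) + T * (ε * ½ * ½)             ≡⟨ solve 2 (λ t e → t :* (e :* con ½ :* con ½) :+ t :* (e :* con ½ :* con ½) := t :* (e :* con ½)) refl T ε ⟩
    T * (ε * ½)                                   ∎)
    where
    open ≤-Reasoning
    T ℙ : ℚ
    T = toℚ n * q ^ℚ w
    ℙ = 𝔼 n (λ xs → 𝟙 (not (atMost q n w xs)))
    0<T : 0ℚ < T
    0<T = *-pos (0<toℚ 1≤n) (^ℚ-pos w 0<q)
    𝟙*T≤count : ∀ xs → length xs ≡ n → 𝟙 (not (atMost q n w xs)) * T ≤ toℚ (unhappyAlphaCount τ xs w)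
    𝟙*T≤count xs _ = 𝟙-not-does-*≤ (ℕtoℚ U ≤? ℕtoℚ n * q ^ℚ w) T (toℚ-nonNeg U)
      (λ U≰T → <⇒≤ (subst₂ _<_ (cong (_* q ^ℚ w) (ℕtoℚ≡toℚ n)) (ℕtoℚ≡toℚ U) (≰⇒> U≰T)))
      where
      U : ℕ
      U = unhappyAlphaCount τ xs w

-- The lower tail

module LowerTail (ρ τ : ℚ) (0<ρ : 0ℚ < ρ) (ρ<1 : ρ < 1ℚ) where

  open Bernoulli ρ (<⇒≤ 0<ρ) (<⇒≤ ρ<1)
  open Unhappiness τ
  open IsolatedBlockStatistics ρ (<⇒≤ 0<ρ) (<⇒≤ ρ<1)

  0<isolatedProb : ∀ w → 0ℚ < isolatedProb ρ w
  0<isolatedProb w = *-pos (^ℚ-pos w 0<ρ) (*-pos (p<q⇒0<q-p ρ<1) (^ℚ-pos w 0<ρ))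

  module _ (q₀ : ℚ) (w : ℕ) (1/size<τ : (ℤ.+ 1 / nbhdSize w) < τ) (n m : ℕ) (1≤m : 1 ℕ.≤ m)
           (mL≤n : m ℕ.* nbhdSize w ℕ.≤ n) (nq₀^w≤K : toℚ n * q₀ ^ℚ w ≤ toℚ m * isolatedProb ρ w * ½) where

    private
      L : ℕ
      L = nbhdSize w
      p : ℚ
      p = isolatedProb ρ w
      K : ℚ
      K = toℚ m * p * ½
      0<K : 0ℚ < K
      0<K = *-pos (*-pos (0<toℚ 1≤m) (0<isolatedProb w)) (positive⁻¹ ½)
      K+K≡mp : K + K ≡ toℚ m * p
      K+K≡mp = solve 2 (λ m p → m :* p :* con ½ :+ m :* p :* con ½ := m :* p) refl (toℚ m) p

    not-atLeast⇒few-isolated : ∀ xs → length xs ≡ n → not (atLeast q₀ n w xs) ≡ true →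
      toℚ (isolatedBlocks w m xs) + K ≤ toℚ m * p
    not-atLeast⇒few-isolated xs refl few = begin
      toℚ (isolatedBlocks w m xs) + K   ≤⟨ +-monoˡ-≤ K (<⇒≤ blocks<K) ⟩
      K + K                             ≡⟨ K+K≡mp ⟩
      toℚ m * p                         ∎
      where
      open ≤-Reasoning
      U : ℕ
      U = unhappyAlphaCount τ xs w
      U<nq₀^w : toℚ U < toℚ n * q₀ ^ℚ w
      U<nq₀^w = subst₂ _<_ (ℕtoℚ≡toℚ U) (cong (_* q₀ ^ℚ w) (ℕtoℚ≡toℚ n))
        (≰⇒> (not-does⇒¬ (ℕtoℚ n * q₀ ^ℚ w ≤? ℕtoℚ U) few))
      blocks<K : toℚ (isolatedBlocks w m xs) < K
      blocks<K = ≤-<-trans (toℚ-mono-≤ (isolatedBlocks≤unhappyAlphaCount w 1/size<τ m xs mL≤n))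
                           (<-≤-trans U<nq₀^w nq₀^w≤K)

    ℙ-not-atLeast≤ : ∀ ε → 0ℚ ≤ ε → toℚ 4 ≤ ε * K → 𝔼 n (λ xs → 𝟙 (not (atLeast q₀ n w xs))) ≤ ε * ½
    ℙ-not-atLeast≤ ε 0≤ε 4≤εK = *-cancelˡ-≤ (toℚ-pos 3) (begin
      toℚ 4 * ℙ          ≤⟨ *-monoʳ-≤ 0≤ℙ 4≤εK ⟩
      ε * K * ℙ          ≡⟨ solve 3 (λ e k p → e :* k :* p := e :* (p :* k)) refl ε K ℙ ⟩
      ε * (ℙ * K)        ≤⟨ *-monoˡ-≤ 0≤ε ℙK≤2 ⟩
      ε * (1ℚ + 1ℚ)      ≡⟨ solve 1 (λ e → e :* (con 1ℚ :+ con 1ℚ) := (con 1ℚ :+ (con 1ℚ :+ (con 1ℚ :+ (con 1ℚ :+ con 0ℚ)))) :* (e :* con ½)) refl ε ⟩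
      toℚ 4 * (ε * ½)    ∎)
      where
      open ≤-Reasoning
      ℙ : ℚ
      ℙ = 𝔼 n (λ xs → 𝟙 (not (atLeast q₀ n w xs)))
      0≤ℙ : 0ℚ ≤ ℙ
      0≤ℙ = 𝔼-nonNeg n (λ xs _ → 𝟙-nonNeg _)
      n≡ : m ℕ.* L ℕ.+ (n ℕ.∸ m ℕ.* L) ≡ n
      n≡ = ℕ.m+[n∸m]≡n mL≤n
      ℙK²≤K+K : ℙ * (K * K) ≤ K + K
      ℙK²≤K+K = begin
        ℙ * (K * K)
          ≤⟨ chebyshev n (λ xs → not (atLeast q₀ n w xs)) (λ xs → toℚ (isolatedBlocks w m xs)) (toℚ m * p) K (<⇒≤ 0<K)
                       not-atLeast⇒few-isolated ⟩
        𝔼 n (λ xs → sq (toℚ (isolatedBlocks w m xs) - toℚ m * p))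
          ≡⟨ cong (λ k → 𝔼 k (λ xs → sq (toℚ (isolatedBlocks w m xs) - toℚ m * p))) (sym n≡) ⟩
        𝔼 (m ℕ.* L ℕ.+ (n ℕ.∸ m ℕ.* L)) (λ xs → sq (toℚ (isolatedBlocks w m xs) - toℚ m * p))
          ≡⟨ variance-isolatedBlocks-prefix w m (n ℕ.∸ m ℕ.* L) ⟩
        toℚ m * (p * (1ℚ - p))
          ≤⟨ *-monoˡ-≤ (toℚ-nonNeg m) (*-monoˡ-≤ (<⇒≤ (0<isolatedProb w)) 1-p≤1) ⟩
        toℚ m * (p * 1ℚ)
          ≡⟨ trans (cong (toℚ m *_) (*-identityʳ p)) (sym K+K≡mp) ⟩
        K + K
          ∎
        where
        1-p≤1 : 1ℚ - p ≤ 1ℚ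
        1-p≤1 = 0≤q-p⇒p≤q (subst (0ℚ ≤_) (solve 1 (λ p → p := con 1ℚ :- (con 1ℚ :- p)) refl p) (<⇒≤ (0<isolatedProb w)))
      ℙK≤2 : ℙ * K ≤ 1ℚ + 1ℚ
      ℙK≤2 = *-cancelˡ-≤ 0<K (subst₂ _≤_ (solve 2 (λ p k → p :* (k :* k) := k :* (p :* k)) refl ℙ K)
                                          (solve 1 (λ k → k :+ k := k :* (con 1ℚ :+ con 1ℚ)) refl K) ℙK²≤K+K)

24w+1≤32^w : ∀ w → 24 ℕ.* w ℕ.+ 1 ℕ.≤ 32 ℕ.^ w
24w+1≤32^w zero    = ℕ.≤-refl
24w+1≤32^w (suc w) = ℕ.≤-trans (subst (24 ℕ.* suc w ℕ.+ 1 ℕ.≤_) (sym (32*[24w+1]≡ w)) (ℕ.m≤m+n _ _))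
                               (ℕ.*-monoʳ-≤ 32 (24w+1≤32^w w))
  where
  open ℕ-Solver using () renaming (_:+_ to _⊕_; _:*_ to _⊛_; _:=_ to _⊜_; con to κ)
  32*[24w+1]≡ : ∀ w → 32 ℕ.* (24 ℕ.* w ℕ.+ 1) ≡ (24 ℕ.* suc w ℕ.+ 1) ℕ.+ (744 ℕ.* w ℕ.+ 7)
  32*[24w+1]≡ = ℕ-Solver.solve 1 (λ w → κ 32 ⊛ (κ 24 ⊛ w ⊕ κ 1) ⊜ (κ 24 ⊛ (κ 1 ⊕ w) ⊕ κ 1) ⊕ (κ 744 ⊛ w ⊕ κ 7)) refl

8*nbhdSize≤32^w : ∀ w → 1 ℕ.≤ w → 8 ℕ.* nbhdSize w ℕ.≤ 32 ℕ.^ w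
8*nbhdSize≤32^w (suc w) _ = ℕ.≤-trans (subst (8 ℕ.* nbhdSize (suc w) ℕ.≤_) (sym (24[1+w]+1≡ w)) (ℕ.m≤m+n _ _)) (24w+1≤32^w (suc w))
  where
  open ℕ-Solver using () renaming (_:+_ to _⊕_; _:*_ to _⊛_; _:=_ to _⊜_; con to κ)
  24[1+w]+1≡ : ∀ w → 24 ℕ.* suc w ℕ.+ 1 ≡ 8 ℕ.* nbhdSize (suc w) ℕ.+ (8 ℕ.* w ℕ.+ 1)
  24[1+w]+1≡ = ℕ-Solver.solve 1 (λ w → κ 24 ⊛ (κ 1 ⊕ w) ⊕ κ 1 ⊜ κ 8 ⊛ (κ 1 ⊕ ((κ 1 ⊕ w) ⊕ (κ 1 ⊕ w))) ⊕ (κ 8 ⊛ w ⊕ κ 1)) refl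

module LowerConstant (ρ : ℚ) (0<ρ : 0ℚ < ρ) (ρ≤½ : ρ ≤ ½) where

  private
    ρ≤1 : ρ ≤ 1ℚ
    ρ≤1 = ≤-trans ρ≤½ (<⇒≤ ½<1)

  private
    σ : ℚ
    σ = 1ℚ - ρ

    1/32 : ℚ
    1/32 = ℤ.+ 1 / 32

    0<1/32 : 0ℚ < 1/32
    0<1/32 = positive⁻¹ 1/32

    ½≤σ : ½ ≤ σ
    ½≤σ = 0≤q-p⇒p≤q (subst (0ℚ ≤_) (solve 1 (λ r → con ½ :- r := (con 1ℚ :- r) :- con ½) refl ρ) (p≤q⇒0≤q-p ρ≤½))

    4*nbhdSize/32^w≤σ/2 : ∀ w → 1 ℕ.≤ w → toℚ 2 * toℚ (nbhdSize w) * 1/32 ^ℚ w ≤ σ * ½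
    4*nbhdSize/32^w≤σ/2 w 1≤w = begin
      toℚ 2 * toℚ L * C                    ≡⟨ solve 2 (λ l c → con (toℚ 2) :* l :* c := con (½ * ½) :* (con (toℚ 8) :* l :* c)) refl (toℚ L) C ⟩
      ½ * ½ * (toℚ 8 * toℚ L * C)          ≡⟨ cong (λ t → ½ * ½ * (t * C)) (sym (toℚ-* 8 L)) ⟩
      ½ * ½ * (toℚ (8 ℕ.* L) * C)          ≤⟨ *-monoˡ-≤ (<⇒≤ (positive⁻¹ (½ * ½))) 8LC≤1 ⟩
      ½ * ½ * 1ℚ                           ≡⟨ *-identityʳ (½ * ½) ⟩
      ½ * ½                                ≤⟨ *-monoʳ-≤ (<⇒≤ (positive⁻¹ ½)) ½≤σ ⟩
      σ * ½                                ∎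
      where
      open ≤-Reasoning
      L : ℕ
      L = nbhdSize w
      C : ℚ
      C = 1/32 ^ℚ w
      8LC≤1 : toℚ (8 ℕ.* L) * C ≤ 1ℚ
      8LC≤1 = begin
        toℚ (8 ℕ.* L) * C          ≤⟨ *-monoʳ-≤ (^ℚ-nonNeg w (<⇒≤ 0<1/32)) (toℚ-mono-≤ (8*nbhdSize≤32^w w 1≤w)) ⟩
        toℚ (32 ℕ.^ w) * C         ≡⟨ cong (_* C) (toℚ-^ 32 w) ⟩
        toℚ 32 ^ℚ w * 1/32 ^ℚ w    ≡⟨ sym (^ℚ-distrib-* (toℚ 32) 1/32 w) ⟩
        (toℚ 32 * 1/32) ^ℚ w       ≤⟨ ^ℚ-≤1 w (<⇒≤ (positive⁻¹ 1ℚ)) ≤-refl ⟩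
        1ℚ                         ∎

  q₀ : ℚ
  q₀ = ρ * ρ * 1/32

  0<q₀ : 0ℚ < q₀
  0<q₀ = *-pos (*-pos 0<ρ 0<ρ) 0<1/32

  q₀<1 : q₀ < 1ℚ
  q₀<1 = ≤-<-trans (subst (q₀ ≤_) (*-identityˡ 1/32) (*-monoʳ-≤ (<⇒≤ 0<1/32) ρρ≤1)) (*<* (ℤ.+<+ (s≤s (s≤s z≤n))))
    where
    ρρ≤1 : ρ * ρ ≤ 1ℚ
    ρρ≤1 = subst (ρ * ρ ≤_) (*-identityˡ 1ℚ) (*-mono-≤ (<⇒≤ 0<ρ) (<⇒≤ 0<ρ) ρ≤1 ρ≤1)

  nq₀^w≤mp/2 : ∀ w → 1 ℕ.≤ w → ∀ m n → n ℕ.≤ 2 ℕ.* (m ℕ.* nbhdSize w) → toℚ n * q₀ ^ℚ w ≤ toℚ m * isolatedProb ρ w * ½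
  nq₀^w≤mp/2 w 1≤w m n n≤2mL = begin
    toℚ n * q₀ ^ℚ w                             ≤⟨ *-monoʳ-≤ (^ℚ-nonNeg w (<⇒≤ 0<q₀)) (toℚ-mono-≤ n≤2mL) ⟩
    toℚ (2 ℕ.* (m ℕ.* L)) * q₀ ^ℚ w             ≡⟨ cong₂ _*_ (trans (toℚ-* 2 (m ℕ.* L)) (cong (toℚ 2 *_) (toℚ-* m L)))
                                                              (trans (^ℚ-distrib-* (ρ * ρ) 1/32 w) (cong (_* C) (^ℚ-distrib-* ρ ρ w))) ⟩
    (toℚ 2 * (toℚ m * toℚ L)) * ((R * R) * C)   ≡⟨ solve 5 (λ a b c r x → (a :* (b :* c)) :* ((r :* r) :* x) := b :* (r :* r) :* ((a :* c) :* x))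
                                                           refl (toℚ 2) (toℚ m) (toℚ L) R C ⟩
    toℚ m * (R * R) * (toℚ 2 * toℚ L * C)       ≤⟨ *-monoˡ-≤ (*-nonNeg (toℚ-nonNeg m) (*-nonNeg (^ℚ-nonNeg w (<⇒≤ 0<ρ)) (^ℚ-nonNeg w (<⇒≤ 0<ρ))))
                                                              (4*nbhdSize/32^w≤σ/2 w 1≤w) ⟩
    toℚ m * (R * R) * (σ * ½)                   ≡⟨ solve 4 (λ m r s h → m :* (r :* r) :* (s :* h) := m :* (r :* (s :* r)) :* h) refl (toℚ m) R σ ½ ⟩
    toℚ m * isolatedProb ρ w * ½                  ∎
    where
    open ≤-Reasoning
    L : ℕ
    L = nbhdSize w
    R C : ℚ
    R = ρ ^ℚ w
    C = 1/32 ^ℚ w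

module UnhappyAlphaCountBounds (ρ τ : ℚ) (0<ρ : 0ℚ < ρ) (ρ≤½ : ρ ≤ ½) (0<τ : 0ℚ < τ) (ρ+τ<1 : ρ + τ < 1ℚ) where

  private
    ρ<1 : ρ < 1ℚ
    ρ<1 = ≤-<-trans ρ≤½ ½<1

    τ<σ : τ < 1ℚ - ρ
    τ<σ = 0<q-p⇒p<q (subst (0ℚ <_) (solve 2 (λ r t → con 1ℚ :- (r :+ t) := (con 1ℚ :- r) :- t) refl ρ τ) (p<q⇒0<q-p ρ+τ<1))

    threshold : Σ ℕ λ a → Σ ℕ λ d → τ * toℚ (suc d) < toℚ a × toℚ a < (1ℚ - ρ) * toℚ (suc d)
    threshold = fraction-between (<⇒≤ 0<τ) τ<σ

  open Bernoulli ρ (<⇒≤ 0<ρ) (<⇒≤ ρ<1) using (Prob≡𝔼; union-bound)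
  open Unhappiness τ using (atLeast; atMost)
  open LowerTail ρ τ 0<ρ ρ<1 using (0<isolatedProb; ℙ-not-atLeast≤)
  open LowerConstant ρ 0<ρ ρ≤½ public using (q₀; 0<q₀; q₀<1)
  open LowerConstant ρ 0<ρ ρ≤½ using (nq₀^w≤mp/2)

  private
    a d : ℕ
    a = proj₁ threshold
    d = proj₁ (proj₂ threshold)
    module Tilt  = ExponentialTilt ρ 0<ρ (<⇒≤ ρ<1) a d (proj₂ (proj₂ (proj₂ threshold)))
    module Upper = UpperTail ρ τ 0<ρ (<⇒≤ ρ<1) a d (proj₁ (proj₂ (proj₂ threshold))) (proj₂ (proj₂ (proj₂ threshold)))

  q₁ : ℚ
  q₁ = Tilt.q

  0<q₁ : 0ℚ < q₁
  0<q₁ = Tilt.0<q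

  q₁<1 : q₁ < 1ℚ
  q₁<1 = Tilt.q<1

  inRange : ℕ → ℕ → List Bool → Bool
  inRange n w xs = atLeast q₀ n w xs ∧ atMost q₁ n w xs

  ℙ-inRange≥1-ε : ∀ ε w n → 0ℚ < ε → (ℤ.+ 1 / nbhdSize w) < τ → 1 ℕ.≤ w → q₁ ^ℚ w ≤ ε * ½ * ½ →
    let m = n ℕ./ nbhdSize w in 1 ℕ.≤ m → toℚ 4 ≤ ε * (toℚ m * isolatedProb ρ w * ½) →
    toℚ (w ℕ.+ w) ≤ toℚ n * q₁ ^ℚ w * (ε * ½ * ½) → 1ℚ - ε ≤ Prob ρ n (inRange n w)
  ℙ-inRange≥1-ε ε w n 0<ε 1/size<τ 1≤w q₁^w≤ε/4 1≤m 4≤εK 2w≤nq₁^wε/4 = begin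
    1ℚ - ε
      ≤⟨ +-monoʳ-≤ 1ℚ (neg-antimono-≤ ℙbad≤ε) ⟩
    1ℚ - (𝔼 n (λ xs → 𝟙 (not (atLeast q₀ n w xs))) + 𝔼 n (λ xs → 𝟙 (not (atMost q₁ n w xs))))
      ≤⟨ union-bound n (atLeast q₀ n w) (atMost q₁ n w) ⟩
    𝔼 n (λ xs → 𝟙 (inRange n w xs))
      ≡⟨ sym (Prob≡𝔼 n (inRange n w)) ⟩
    Prob ρ n (inRange n w)
      ∎
    where
    open ≤-Reasoning
    open Bernoulli ρ (<⇒≤ 0<ρ) (<⇒≤ ρ<1) using (𝔼)
    m : ℕ
    m = n ℕ./ nbhdSize w
    mL≤n : m ℕ.* nbhdSize w ℕ.≤ n
    mL≤n = ℕ.m/n*n≤m n (nbhdSize w)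
    1≤n : 1 ℕ.≤ n
    1≤n = ℕ.≤-trans (ℕ.*-mono-≤ 1≤m (s≤s z≤n)) mL≤n
    ℙbad≤ε : 𝔼 n (λ xs → 𝟙 (not (atLeast q₀ n w xs))) + 𝔼 n (λ xs → 𝟙 (not (atMost q₁ n w xs))) ≤ ε
    ℙbad≤ε = ≤-trans
      (+-mono-≤ (ℙ-not-atLeast≤ q₀ w 1/size<τ n m 1≤m mL≤n (nq₀^w≤mp/2 w 1≤w m n (blocks-fill n (w ℕ.+ w) 1≤m)) ε (<⇒≤ 0<ε) 4≤εK)
                (Upper.ℙ-not-atMost≤ w n ε 1≤n q₁^w≤ε/4 2w≤nq₁^wε/4))
      (≤-reflexive (solve 1 (λ e → e :* con ½ :+ e :* con ½ := e) refl ε))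

  large-w : ∀ ε → 0ℚ < ε → Σ ℕ λ w₀ → ∀ w → w₀ ℕ.≤ w →
    (ℤ.+ 1 / nbhdSize w) < τ × 1 ℕ.≤ w × q₁ ^ℚ w ≤ ε * ½ * ½
  large-w ε 0<ε = Nτ ℕ.⊔ (Nq ℕ.⊔ 1) , λ w w₀≤w →
    proj₂ τ-bound w (ℕ.m⊔n≤o⇒m≤o Nτ _ w₀≤w) ,
    ℕ.m⊔n≤o⇒n≤o Nq 1 (ℕ.m⊔n≤o⇒n≤o Nτ _ w₀≤w) ,
    proj₂ q-bound w (ℕ.m⊔n≤o⇒m≤o Nq 1 (ℕ.m⊔n≤o⇒n≤o Nτ _ w₀≤w))
    where
    τ-bound : Σ ℕ λ N → ∀ w → N ℕ.≤ w → (ℤ.+ 1 / nbhdSize w) < τ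
    τ-bound = 1/nbhdSize<-eventually 0<τ
    q-bound : Σ ℕ λ N → ∀ w → N ℕ.≤ w → q₁ ^ℚ w ≤ ε * ½ * ½
    q-bound = ^ℚ-eventually-≤ (<⇒≤ 0<q₁) q₁<1 (*-pos (*-pos 0<ε (positive⁻¹ ½)) (positive⁻¹ ½))
    Nτ Nq : ℕ
    Nτ = proj₁ τ-bound
    Nq = proj₁ q-bound

  large-n : ∀ ε w → 0ℚ < ε → Σ ℕ λ n₀ → ∀ n → n₀ ℕ.≤ n →
    1 ℕ.≤ n ℕ./ nbhdSize w × toℚ 4 ≤ ε * (toℚ (n ℕ./ nbhdSize w) * isolatedProb ρ w * ½) ×
    toℚ (w ℕ.+ w) ≤ toℚ n * q₁ ^ℚ w * (ε * ½ * ½)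
  large-n ε w 0<ε = (M ℕ.⊔ 1) ℕ.* L ℕ.⊔ N , λ n n₀≤n →
    ℕ.≤-trans (ℕ.m≤n⊔m M 1) (M⊔1≤n/L n (ℕ.m⊔n≤o⇒m≤o _ N n₀≤n)) ,
    ≤-trans (proj₂ m-bound (n ℕ./ L) (ℕ.≤-trans (ℕ.m≤m⊔n M 1) (M⊔1≤n/L n (ℕ.m⊔n≤o⇒m≤o _ N n₀≤n))))
            (≤-reflexive (solve 3 (λ m e p → m :* (e :* (p :* con ½)) := e :* (m :* p :* con ½)) refl (toℚ (n ℕ./ L)) ε (isolatedProb ρ w))) ,
    ≤-trans (proj₂ n-bound n (ℕ.m⊔n≤o⇒n≤o _ N n₀≤n)) (≤-reflexive (sym (*-assoc (toℚ n) (q₁ ^ℚ w) (ε * ½ * ½))))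
    where
    L : ℕ
    L = nbhdSize w
    m-bound : Σ ℕ λ M → ∀ m → M ℕ.≤ m → toℚ 4 ≤ toℚ m * (ε * (isolatedProb ρ w * ½))
    m-bound = eventually-≤-toℚ* (toℚ 4) (ε * (isolatedProb ρ w * ½)) (*-pos 0<ε (*-pos (0<isolatedProb w) (positive⁻¹ ½)))
    n-bound : Σ ℕ λ N → ∀ n → N ℕ.≤ n → toℚ (w ℕ.+ w) ≤ toℚ n * (q₁ ^ℚ w * (ε * ½ * ½))
    n-bound = eventually-≤-toℚ* (toℚ (w ℕ.+ w)) (q₁ ^ℚ w * (ε * ½ * ½)) (*-pos (^ℚ-pos w 0<q₁) (*-pos (*-pos 0<ε (positive⁻¹ ½)) (positive⁻¹ ½)))
    M N : ℕ
    M = proj₁ m-bound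
    N = proj₁ n-bound
    M⊔1≤n/L : ∀ n → (M ℕ.⊔ 1) ℕ.* L ℕ.≤ n → M ℕ.⊔ 1 ℕ.≤ n ℕ./ L
    M⊔1≤n/L n [M⊔1]L≤n = subst (ℕ._≤ n ℕ./ L) (ℕ.m*n/n≡m (M ℕ.⊔ 1) L) (ℕ./-monoˡ-≤ L [M⊔1]L≤n)

  with-high-probability : ∀ ε → 0ℚ < ε → Σ ℕ λ w₀ → ∀ w → w ≥ w₀ → Σ ℕ λ n₀ → ∀ n → n ≥ n₀ →
    1ℚ - ε ≤ Prob ρ n (inRange n w)
  with-high-probability ε 0<ε = proj₁ (large-w ε 0<ε) , λ w w≥w₀ →
    proj₁ (large-n ε w 0<ε) , λ n n≥n₀ →
    let 1/size<τ , 1≤w , q₁^w≤ε/4 = proj₂ (large-w ε 0<ε) w w≥w₀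
        1≤m , 4≤εK , 2w≤nq₁^wε/4  = proj₂ (large-n ε w 0<ε) n n≥n₀
    in ℙ-inRange≥1-ε ε w n 0<ε 1/size<τ 1≤w q₁^w≤ε/4 1≤m 4≤εK 2w≤nq₁^wε/4

mainTheorem16 : (ρ τ : ℚ) → 0ℚ < ρ → ρ ≤ Data.Rational.½ → 0ℚ < τ → ρ + τ < 1ℚ →
    Σ ℚ λ q₀ → Σ ℚ λ q₁ → (0ℚ < q₀ × q₀ < 1ℚ) × (0ℚ < q₁ × q₁ < 1ℚ) ×
      ((ε : ℚ) → 0ℚ < ε → Σ ℕ λ w₀ → (w : ℕ) → w ≥ w₀ → Σ ℕ λ n₀ → (n : ℕ) → n ≥ n₀ →
        1ℚ - ε ≤ Prob ρ n (λ xs →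
          does (ℕtoℚ n * (q₀ ^ℚ w) ≤? ℕtoℚ (unhappyAlphaCount τ xs w)) ∧
          does (ℕtoℚ (unhappyAlphaCount τ xs w) ≤? ℕtoℚ n * (q₁ ^ℚ w))))
mainTheorem16 ρ τ 0<ρ ρ≤½ 0<τ ρ+τ<1 = q₀ , q₁ , (0<q₀ , q₀<1) , (0<q₁ , q₁<1) , with-high-probability
  where open UnhappyAlphaCountBounds ρ τ 0<ρ ρ≤½ 0<τ ρ+τ<1
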